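{- Let $(\Gamma,\Delta)$ be a connected admissible Dynkin biagram. Then all irreducible components (connected Dynkin diagrams) of $\Gamma$ have the same Coxeter number, and all irreducible components of $\Delta$ have the same Coxeter number.
   Context: A Cartan matrix of finite type is an integer matrix which after a simultaneous permutation of rows and columns is block diagonal with blocks Cartan matrices of connected Dynkin diagrams ($A_m,B_m,C_m,D_m,E_{6,7,8},F_4,G_2$, not necessarily simply-laced); its Coxeter adjacency matrix is $2I-C$, and the blocks are its irreducible components. A Dynkin biagram is a pair $(\Gamma,\Delta)$ of $n\times n$ Coxeter adjacency matrices such that no position $(i,j)$ has both $\Gamma_{ij}\ne0$ and $\Delta_{ij}\ne0$, and there is $\epsilon:[n]\to\{\circ,\bullet\}$ with $\Gamma_{ij}=\Delta_{ij}=0$ whenever $\epsilon_i=\epsilon_j$. It is admissible if $\Gamma\Delta=\Delta\Gamma$, and connected if the graph on $[n]$ with an edge $\{i,j\}$ whenever $(\Gamma+\Delta)_{ij}\neq0$ is connected. -}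

module Defs where

open import Data.Nat using (ℕ; zero; suc; _+_; _*_; _≡ᵇ_; _≤ᵇ_)
open import Data.Bool using (Bool; true; false; if_then_else_; _∧_; _∨_)
open import Data.Integer as ℤ using (ℤ; +_; -_)
open import Data.Fin using (Fin; toℕ; _≟_)
open import Data.Product using (Σ; _×_; _,_)
open import Function.Bundles using (_↔_; Inverse)
open import Relation.Binary.PropositionalEquality using (_≡_; _≢_; refl)
open import Relation.Nullary using (yes; no)
open import Data.Empty using (⊥)
open import Data.Sum using (_⊎_)

Mat : ℕ → Set
Mat n = Fin n → Fin n → ℤ

δ : ∀ {n} → Fin n → Fin n → ℤ
δ i j with i ≟ j
... | yes _ = + 1
... | no  _ = + 0

sumFin : ∀ {n} → (Fin n → ℤ) → ℤ
sumFin {zero}  f = + 0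
sumFin {suc n} f = f Fin.zero ℤ.+ sumFin (λ i → f (Fin.suc i))

_⊗_ : ∀ {n} → Mat n → Mat n → Mat n
(A ⊗ B) i j = sumFin (λ l → A i l ℤ.* B l j)

_⊕_ : ∀ {n} → Mat n → Mat n → Mat n
(A ⊕ B) i j = A i j ℤ.+ B i j

-- Connected Dynkin diagrams (types), with ranks:
--   A m = A_{m+1},  B m = B_{m+2},  C m = C_{m+3},  D m = D_{m+4}

data DynkinType : Set where
  A B C D : ℕ → DynkinType
  E6 E7 E8 F4 G2 : DynkinType

rank : DynkinType → ℕ
rank (A m) = 1 + m
rank (B m) = 2 + m
rank (C m) = 3 + m
rank (D m) = 4 + m
rank E6 = 6
rank E7 = 7
rank E8 = 8
rank F4 = 4
rank G2 = 2

coxeterNumber : DynkinType → ℕ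
coxeterNumber (A m) = 2 + m            -- h(A_r) = r + 1
coxeterNumber (B m) = 2 * (2 + m)      -- h(B_r) = 2r
coxeterNumber (C m) = 2 * (3 + m)      -- h(C_r) = 2r
coxeterNumber (D m) = 6 + 2 * m        -- h(D_r) = 2r - 2
coxeterNumber E6 = 12
coxeterNumber E7 = 18
coxeterNumber E8 = 30
coxeterNumber F4 = 12
coxeterNumber G2 = 6

chain : ℕ → ℕ → ℕ
chain i j = if (suc i ≡ᵇ j) ∨ (suc j ≡ᵇ i) then 1 else 0

eEdge : ℕ → ℕ → Bool
eEdge i j = ((i ≡ᵇ 0) ∧ (j ≡ᵇ 2)) ∨ ((i ≡ᵇ 1) ∧ (j ≡ᵇ 3)) ∨ ((2 ≤ᵇ i) ∧ (suc i ≡ᵇ j))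

-- E_n: chain 0 - 2 - 3 - ... - (n-1), node 1 attached to node 3
eAdj : ℕ → ℕ → ℕ
eAdj i j = if eEdge i j ∨ eEdge j i then 1 else 0

-- off-diagonal entries (i ≠ j) of minus the Cartan matrix, on nodes 0 .. rank-1
-- (Bourbaki numbering, up to shifting indices by one)
negCartanOff : DynkinType → ℕ → ℕ → ℕ
negCartanOff (A m) i j = chain i j
negCartanOff (B m) i j = if (i ≡ᵇ suc m) ∧ (j ≡ᵇ m) then 2 else chain i j
negCartanOff (C m) i j = if (i ≡ᵇ suc m) ∧ (j ≡ᵇ suc (suc m)) then 2 else chain i j
negCartanOff (D m) i j =
  if ((i ≡ᵇ 3 + m) ∧ (j ≡ᵇ 1 + m)) ∨ ((j ≡ᵇ 3 + m) ∧ (i ≡ᵇ 1 + m)) then 1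
  else (if (i ≡ᵇ 3 + m) ∨ (j ≡ᵇ 3 + m) then 0 else chain i j)
negCartanOff E6 i j = eAdj i j
negCartanOff E7 i j = eAdj i j
negCartanOff E8 i j = eAdj i j
negCartanOff F4 i j = if (i ≡ᵇ 1) ∧ (j ≡ᵇ 2) then 2 else chain i j
negCartanOff G2 i j = if (i ≡ᵇ 1) ∧ (j ≡ᵇ 0) then 3 else chain i j

cartan : (t : DynkinType) → Mat (rank t)
cartan t i j =
  if toℕ i ≡ᵇ toℕ j then + 2 else - (+ negCartanOff t (toℕ i) (toℕ j))

-- Cartan matrices of finite type: up to a simultaneous permutation of
-- rows and columns, block diagonal with blocks Cartan matrices of
-- connected Dynkin diagrams.

blockDiag : ∀ {k} (τ : Fin k → DynkinType) →
            Σ (Fin k) (λ b → Fin (rank (τ b))) →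
            Σ (Fin k) (λ b → Fin (rank (τ b))) → ℤ
blockDiag τ (b , p) (b' , p') with b ≟ b'
... | yes refl = cartan (τ b) p p'
... | no  _    = + 0

record Decomposition {n : ℕ} (Cm : Mat n) : Set where
  field
    blocks  : ℕ
    τ       : Fin blocks → DynkinType
    σ       : Fin n ↔ Σ (Fin blocks) (λ b → Fin (rank (τ b)))
    entries : ∀ i j → Cm i j ≡ blockDiag τ (Inverse.to σ i) (Inverse.to σ j)

IsCartanFiniteType : ∀ {n} → Mat n → Set
IsCartanFiniteType Cm = Decomposition Cm

cartanOf : ∀ {n} → Mat n → Mat n
cartanOf Γ i j = (+ 2) ℤ.* δ i j ℤ.- Γ i j

IsCoxeterAdjacency : ∀ {n} → Mat n → Set
IsCoxeterAdjacency Γ = IsCartanFiniteType (cartanOf Γ)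

SameCoxeterNumber : ∀ {n} → Mat n → Set
SameCoxeterNumber Γ =
  (d : Decomposition (cartanOf Γ)) → (b b' : Fin (Decomposition.blocks d)) →
  coxeterNumber (Decomposition.τ d b) ≡ coxeterNumber (Decomposition.τ d b')

data Color : Set where
  white black : Color

record IsDynkinBiagram {n : ℕ} (Γ Δ : Mat n) : Set where
  field
    Γ-cox    : IsCoxeterAdjacency Γ
    Δ-cox    : IsCoxeterAdjacency Δ
    disjoint : ∀ i j → Γ i j ≢ + 0 → Δ i j ≢ + 0 → ⊥
    ε        : Fin n → Color
    bipartΓ  : ∀ i j → ε i ≡ ε j → Γ i j ≡ + 0
    bipartΔ  : ∀ i j → ε i ≡ ε j → Δ i j ≡ + 0

Admissible : ∀ {n} → Mat n → Mat n → Set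
Admissible Γ Δ = ∀ i j → (Γ ⊗ Δ) i j ≡ (Δ ⊗ Γ) i j

data Walk {n : ℕ} (Γ Δ : Mat n) : Fin n → Fin n → Set where
  here : ∀ {i} → Walk Γ Δ i i
  step : ∀ {i j k} → ((Γ ⊕ Δ) i j ≢ + 0 ⊎ (Γ ⊕ Δ) j i ≢ + 0) →
         Walk Γ Δ j k → Walk Γ Δ i k

Connected : ∀ {n} → Mat n → Mat n → Set
Connected Γ Δ = ∀ i j → Walk Γ Δ i j

-- Let A be the adjacency matrix of a connected Dynkin diagram with Coxeter number h.  The
-- Chebyshev recursion x₀ = 0, x_{k+2} = x_{k+1} A − x_k has an integral solution which is
-- positive for 0 < k < h and vanishes at k = h (2 cos(π/h) is the Perron–Frobenius
-- eigenvalue of A), and so has its column version x_{k+2} = A x_{k+1} − x_k.  Placed on a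
-- block K of Γ, such solutions become u_k = U_{k−1}(Γ/2) u₁ and v_k = U_{k−1}(Γ/2) v₁.  When
-- Γ commutes with Δ ≥ 0, Γ is self-adjoint for the form uᵀ Δ v, so if Δ_ij > 0 joins blocks
-- K ∋ i and L ∋ j with h_K < h_L, then
--   0 = u_{h_K}ᵀ Δ v₁ = u₁ᵀ Δ v_{h_K} > 0.
-- Hence the Coxeter number is constant along edges of Δ, trivially along edges of Γ, and
-- thus on every connected biagram.  Exchanging Γ and Δ gives the statement for Δ.

module Submission where

open import Defs
open import Data.Product using (_×_)

open import Data.Bool using (Bool; true; false; if_then_else_; _∧_; T)
import Data.Bool.Properties as Boolₚ
open import Data.Empty using (⊥-elim)
open import Data.Fin using (Fin; toℕ; fromℕ<; _≟_)
import Data.Fin as F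
import Data.Fin.Properties as Finₚ
open import Data.Integer as ℤ using (ℤ; +_; -_; _+_; _-_; _*_; _≤_; _<_; +≤+; +<+)
import Data.Integer.Properties as ℤₚ
open import Algebra.Properties.Semiring.Sum ℤₚ.+-*-semiring
  using (sum; sum-cong-≗; ∑-distrib-+; ∑-comm; *-distribˡ-sum; *-distribʳ-sum; sum-replicate-zero)
open import Data.Integer.Tactic.RingSolver using (solve-∀)
open import Data.List using (List; []; _∷_)
open import Data.Nat as ℕ using (ℕ; zero; suc; z≤n; s≤s; _≡ᵇ_)
import Data.Nat.Properties as ℕₚ
import Data.Nat.Tactic.RingSolver as ℕ-Solver
open import Data.Product using (Σ; _,_; proj₁; proj₂)
open import Data.Sum using (_⊎_; inj₁; inj₂; [_,_]′)
open import Data.Vec.Functional using (Vector)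
open import Function using (_∘_; flip; _∋_)
open import Function.Bundles using (Inverse)
open import Relation.Binary.PropositionalEquality
open import Relation.Nullary using (yes; no; ¬_; Dec)
open import Relation.Nullary.Decidable using (True; toWitness; _×-dec_; _→-dec_)

sumFin≡sum : ∀ {n} (f : Vector ℤ n) → sumFin f ≡ sum f
sumFin≡sum {zero}  f = refl
sumFin≡sum {suc n} f = cong (_+_ (f F.zero)) (sumFin≡sum (f ∘ F.suc))

sum-zero : ∀ {n} (f : Vector ℤ n) → f ≗ (λ _ → + 0) → sum f ≡ + 0
sum-zero {n} f f≗0 = trans (sum-cong-≗ f≗0) (sum-replicate-zero n)

sum-neg : ∀ {n} (f : Vector ℤ n) → sum (λ i → - f i) ≡ - sum f
sum-neg {zero}  f = refl
sum-neg {suc n} f =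
  trans (cong (_+_ (- f F.zero)) (sum-neg (f ∘ F.suc))) (sym (ℤₚ.neg-distrib-+ (f F.zero) _))

sum-distrib-- : ∀ {n} (f g : Vector ℤ n) → sum (λ i → f i - g i) ≡ sum f - sum g
sum-distrib-- f g = trans (∑-distrib-+ f (λ i → - g i)) (cong (_+_ (sum f)) (sum-neg g))

δ-≢ : ∀ {n} {i j : Fin n} → i ≢ j → δ i j ≡ + 0
δ-≢ {i = i} {j} i≢j with i ≟ j
... | yes i≡j = ⊥-elim (i≢j i≡j)
... | no _    = refl

δ-sym : ∀ {n} (x y : Fin n) → δ x y ≡ δ y x
δ-sym x y with x ≟ y | y ≟ x
... | yes _    | yes _    = refl
... | no _     | no _     = refl
... | yes refl | no y≢x   = ⊥-elim (y≢x refl)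
... | no x≢y   | yes refl = ⊥-elim (x≢y refl)

sum-δˡ : ∀ {n} (x : Fin n) (g : Vector ℤ n) → sum (λ l → δ x l * g l) ≡ g x
sum-δˡ F.zero g =
  trans (cong₂ _+_ (ℤₚ.*-identityˡ (g F.zero)) (sum-zero _ (λ l → ℤₚ.*-zeroˡ (g (F.suc l)))))
        (ℤₚ.+-identityʳ _)
sum-δˡ (F.suc x) g =
  trans (cong₂ _+_ (ℤₚ.*-zeroˡ (g F.zero))
                   (trans (sum-cong-≗ (λ l → cong (_* g (F.suc l)) (δ-suc l))) (sum-δˡ x (g ∘ F.suc))))
        (ℤₚ.+-identityˡ _)
  where
  δ-suc : ∀ l → δ (F.suc x) (F.suc l) ≡ δ x l
  δ-suc l with x ≟ l
  ... | yes refl = refl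
  ... | no _     = refl

sum-δʳ : ∀ {n} (x : Fin n) (g : Vector ℤ n) → sum (λ l → δ l x * g l) ≡ g x
sum-δʳ x g = trans (sum-cong-≗ (λ l → cong (_* g l) (δ-sym l x))) (sum-δˡ x g)

sum-nonneg : ∀ {n} (f : Vector ℤ n) → (∀ i → + 0 ≤ f i) → + 0 ≤ sum f
sum-nonneg {zero}  f f≥0 = ℤₚ.≤-refl
sum-nonneg {suc n} f f≥0 = ℤₚ.+-mono-≤ (f≥0 F.zero) (sum-nonneg _ (f≥0 ∘ F.suc))

sum-pos : ∀ {n} (f : Vector ℤ n) → (∀ i → + 0 ≤ f i) → ∀ i → + 0 < f i → + 0 < sum f
sum-pos f f≥0 F.zero    fi>0 = ℤₚ.+-mono-<-≤ fi>0 (sum-nonneg _ (f≥0 ∘ F.suc))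
sum-pos f f≥0 (F.suc i) fi>0 = ℤₚ.+-mono-≤-< (f≥0 F.zero) (sum-pos _ (f≥0 ∘ F.suc) i fi>0)

*-nonneg : ∀ {a b} → + 0 ≤ a → + 0 ≤ b → + 0 ≤ a * b
*-nonneg {+ m} {+ n} _ _ = subst (+ 0 ≤_) (ℤₚ.pos-* m n) (+≤+ z≤n)

*-pos : ∀ {a b} → + 0 < a → + 0 < b → + 0 < a * b
*-pos {+ suc m} {+ suc n} _ _        = +<+ (s≤s z≤n)
*-pos {+ zero}            (+<+ ()) _
*-pos {+ suc m} {+ zero}  _ (+<+ ())

_*ᵥ_ : ∀ {n} → Mat n → Vector ℤ n → Vector ℤ n
(M *ᵥ v) i = sum (λ l → M i l * v l)

_ᵥ*_ : ∀ {n} → Vector ℤ n → Mat n → Vector ℤ n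
(u ᵥ* M) j = sum (λ l → u l * M l j)

*ᵥ-cong : ∀ {n} (M : Mat n) {v w : Vector ℤ n} → v ≗ w → M *ᵥ v ≗ M *ᵥ w
*ᵥ-cong M v≗w i = sum-cong-≗ (λ l → cong (M i l *_) (v≗w l))

ᵥ*-cong : ∀ {n} (M : Mat n) {v w : Vector ℤ n} → v ≗ w → v ᵥ* M ≗ w ᵥ* M
ᵥ*-cong M v≗w j = sum-cong-≗ (λ l → cong (_* M l j) (v≗w l))

*ᵥ-zero : ∀ {n} (M : Mat n) → M *ᵥ (λ _ → + 0) ≗ (λ _ → + 0)
*ᵥ-zero M i = sum-zero _ (λ l → ℤₚ.*-zeroʳ (M i l))

*ᵥ-distrib-- : ∀ {n} (M : Mat n) (v w : Vector ℤ n) →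
               M *ᵥ (λ j → v j - w j) ≗ (λ i → (M *ᵥ v) i - (M *ᵥ w) i)
*ᵥ-distrib-- M v w i =
  trans (sum-cong-≗ (λ l → a[b-c]≡ab-ac (M i l) (v l) (w l)))
        (sum-distrib-- (λ l → M i l * v l) (λ l → M i l * w l))
  where
  a[b-c]≡ab-ac : ∀ a b c → a * (b - c) ≡ a * b - a * c
  a[b-c]≡ab-ac = solve-∀

*ᵥ-assoc : ∀ {n} (M N : Mat n) (v : Vector ℤ n) → M *ᵥ (N *ᵥ v) ≗ (M ⊗ N) *ᵥ v
*ᵥ-assoc M N v i = begin
  sum (λ l → M i l * sum (λ j → N l j * v j))
    ≡⟨ sum-cong-≗ (λ l → *-distribˡ-sum (M i l) (λ j → N l j * v j)) ⟩
  sum (λ l → sum (λ j → M i l * (N l j * v j)))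
    ≡⟨ ∑-comm (λ l j → M i l * (N l j * v j)) ⟩
  sum (λ j → sum (λ l → M i l * (N l j * v j)))
    ≡⟨ sum-cong-≗ (λ j → sum-cong-≗ (λ l → sym (ℤₚ.*-assoc (M i l) (N l j) (v j)))) ⟩
  sum (λ j → sum (λ l → M i l * N l j * v j))
    ≡⟨ sum-cong-≗ (λ j → sym (*-distribʳ-sum (v j) (λ l → M i l * N l j))) ⟩
  sum (λ j → sum (λ l → M i l * N l j) * v j)
    ≡⟨ sum-cong-≗ (λ j → cong (_* v j) (sym (sumFin≡sum (λ l → M i l * N l j)))) ⟩
  sum (λ j → (M ⊗ N) i j * v j) ∎
  where open ≡-Reasoning

-- chebyshev Φ u k = U_{k-1}(Φ/2) u, for U the Chebyshev polynomials of the second kind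
chebyshev : ∀ {n} → (Vector ℤ n → Vector ℤ n) → Vector ℤ n → ℕ → Vector ℤ n
chebyshev Φ u zero          _ = + 0
chebyshev Φ u (suc zero)    i = u i
chebyshev Φ u (suc (suc k)) i = Φ (chebyshev Φ u (suc k)) i - chebyshev Φ u k i

chebyshev-*ᵥ : ∀ {n} (Γ : Mat n) v k → chebyshev (Γ *ᵥ_) (Γ *ᵥ v) k ≗ Γ *ᵥ chebyshev (Γ *ᵥ_) v k
chebyshev-*ᵥ Γ v zero          i = sym (*ᵥ-zero Γ i)
chebyshev-*ᵥ Γ v (suc zero)    i = refl
chebyshev-*ᵥ Γ v (suc (suc k)) i =
  trans (cong₂ _-_ (*ᵥ-cong Γ (chebyshev-*ᵥ Γ v (suc k)) i) (chebyshev-*ᵥ Γ v k i))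
        (sym (*ᵥ-distrib-- Γ (Γ *ᵥ chebyshev (Γ *ᵥ_) v (suc k)) (chebyshev (Γ *ᵥ_) v k) i))

module Form {n} (Γ Δ : Mat n) (ΓΔ≡ΔΓ : Admissible Γ Δ) where

  ⟨_∣_⟩ : Vector ℤ n → Vector ℤ n → ℤ
  ⟨ u ∣ v ⟩ = sum (λ i → u i * (Δ *ᵥ v) i)

  ⟨∣⟩-congˡ : ∀ {u u′} v → u ≗ u′ → ⟨ u ∣ v ⟩ ≡ ⟨ u′ ∣ v ⟩
  ⟨∣⟩-congˡ v u≗u′ = sum-cong-≗ (λ i → cong (_* (Δ *ᵥ v) i) (u≗u′ i))

  ⟨∣⟩-congʳ : ∀ u {v v′} → v ≗ v′ → ⟨ u ∣ v ⟩ ≡ ⟨ u ∣ v′ ⟩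
  ⟨∣⟩-congʳ u v≗v′ = sum-cong-≗ (λ i → cong (u i *_) (*ᵥ-cong Δ v≗v′ i))

  ⟨∣⟩-zeroˡ : ∀ v → ⟨ (λ _ → + 0) ∣ v ⟩ ≡ + 0
  ⟨∣⟩-zeroˡ v = sum-zero _ (λ i → ℤₚ.*-zeroˡ ((Δ *ᵥ v) i))

  ⟨∣⟩-zeroʳ : ∀ u → ⟨ u ∣ (λ _ → + 0) ⟩ ≡ + 0
  ⟨∣⟩-zeroʳ u = sum-zero _ (λ i → trans (cong (u i *_) (*ᵥ-zero Δ i)) (ℤₚ.*-zeroʳ (u i)))

  ⟨∣⟩-distribˡ-- : ∀ u w v → ⟨ (λ i → u i - w i) ∣ v ⟩ ≡ ⟨ u ∣ v ⟩ - ⟨ w ∣ v ⟩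
  ⟨∣⟩-distribˡ-- u w v =
    trans (sum-cong-≗ (λ i → [a-b]c≡ac-bc (u i) (w i) ((Δ *ᵥ v) i)))
          (sum-distrib-- (λ i → u i * (Δ *ᵥ v) i) (λ i → w i * (Δ *ᵥ v) i))
    where
    [a-b]c≡ac-bc : ∀ a b c → (a - b) * c ≡ a * c - b * c
    [a-b]c≡ac-bc = solve-∀

  ⟨∣⟩-distribʳ-- : ∀ u v w → ⟨ u ∣ (λ i → v i - w i) ⟩ ≡ ⟨ u ∣ v ⟩ - ⟨ u ∣ w ⟩
  ⟨∣⟩-distribʳ-- u v w =
    trans (sum-cong-≗ (λ i → trans (cong (u i *_) (*ᵥ-distrib-- Δ v w i))
                                   (a[b-c]≡ab-ac (u i) ((Δ *ᵥ v) i) ((Δ *ᵥ w) i))))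
          (sum-distrib-- (λ i → u i * (Δ *ᵥ v) i) (λ i → u i * (Δ *ᵥ w) i))
    where
    a[b-c]≡ab-ac : ∀ a b c → a * (b - c) ≡ a * b - a * c
    a[b-c]≡ab-ac = solve-∀

  ⟨ᵥ*∣⟩ : ∀ u v → ⟨ u ᵥ* Γ ∣ v ⟩ ≡ ⟨ u ∣ Γ *ᵥ v ⟩
  ⟨ᵥ*∣⟩ u v = begin
    sum (λ i → sum (λ l → u l * Γ l i) * Δv i)
      ≡⟨ sum-cong-≗ (λ i → *-distribʳ-sum (Δv i) (λ l → u l * Γ l i)) ⟩
    sum (λ i → sum (λ l → u l * Γ l i * Δv i))
      ≡⟨ ∑-comm (λ i l → u l * Γ l i * Δv i) ⟩
    sum (λ l → sum (λ i → u l * Γ l i * Δv i))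
      ≡⟨ sum-cong-≗ (λ l → sum-cong-≗ (λ i → ℤₚ.*-assoc (u l) (Γ l i) (Δv i))) ⟩
    sum (λ l → sum (λ i → u l * (Γ l i * Δv i)))
      ≡⟨ sum-cong-≗ (λ l → sym (*-distribˡ-sum (u l) (λ i → Γ l i * Δv i))) ⟩
    sum (λ l → u l * (Γ *ᵥ Δv) l)
      ≡⟨ sum-cong-≗ (λ l → cong (u l *_) (Γ*ᵥΔv≗Δ*ᵥΓv l)) ⟩
    sum (λ l → u l * (Δ *ᵥ (Γ *ᵥ v)) l) ∎
    where
    open ≡-Reasoning
    Δv = Δ *ᵥ v
    Γ*ᵥΔv≗Δ*ᵥΓv : Γ *ᵥ Δv ≗ Δ *ᵥ (Γ *ᵥ v)
    Γ*ᵥΔv≗Δ*ᵥΓv l = begin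
      (Γ *ᵥ Δv) l         ≡⟨ *ᵥ-assoc Γ Δ v l ⟩
      ((Γ ⊗ Δ) *ᵥ v) l    ≡⟨ sum-cong-≗ (λ j → cong (_* v j) (ΓΔ≡ΔΓ l j)) ⟩
      ((Δ ⊗ Γ) *ᵥ v) l    ≡⟨ sym (*ᵥ-assoc Δ Γ v l) ⟩
      (Δ *ᵥ (Γ *ᵥ v)) l   ∎

  ⟨chebyshev∣⟩ : ∀ u v k → ⟨ chebyshev (_ᵥ* Γ) u k ∣ v ⟩ ≡ ⟨ u ∣ chebyshev (Γ *ᵥ_) v k ⟩
  ⟨chebyshev∣⟩ u v zero          = trans (⟨∣⟩-zeroˡ v) (sym (⟨∣⟩-zeroʳ u))
  ⟨chebyshev∣⟩ u v (suc zero)    = refl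
  ⟨chebyshev∣⟩ u v (suc (suc k)) = begin
    ⟨ chebyshev (_ᵥ* Γ) u (suc (suc k)) ∣ v ⟩
      ≡⟨ ⟨∣⟩-distribˡ-- (uₖ₊₁ ᵥ* Γ) uₖ v ⟩
    ⟨ uₖ₊₁ ᵥ* Γ ∣ v ⟩ - ⟨ uₖ ∣ v ⟩
      ≡⟨ cong₂ _-_ (trans (⟨ᵥ*∣⟩ uₖ₊₁ v) (⟨chebyshev∣⟩ u (Γ *ᵥ v) (suc k)))
                   (⟨chebyshev∣⟩ u v k) ⟩
    ⟨ u ∣ chebyshev (Γ *ᵥ_) (Γ *ᵥ v) (suc k) ⟩ - ⟨ u ∣ vₖ ⟩
      ≡⟨ cong (_- ⟨ u ∣ vₖ ⟩) (⟨∣⟩-congʳ u (chebyshev-*ᵥ Γ v (suc k))) ⟩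
    ⟨ u ∣ Γ *ᵥ vₖ₊₁ ⟩ - ⟨ u ∣ vₖ ⟩
      ≡⟨ sym (⟨∣⟩-distribʳ-- u (Γ *ᵥ vₖ₊₁) vₖ) ⟩
    ⟨ u ∣ chebyshev (Γ *ᵥ_) v (suc (suc k)) ⟩ ∎
    where
    open ≡-Reasoning
    uₖ₊₁ = chebyshev (_ᵥ* Γ) u (suc k)
    uₖ   = chebyshev (_ᵥ* Γ) u k
    vₖ₊₁ = chebyshev (Γ *ᵥ_) v (suc k)
    vₖ   = chebyshev (Γ *ᵥ_) v k

  ⟨∣⟩-pos : (∀ i j → + 0 ≤ Δ i j) → ∀ {u v} → (∀ i → + 0 ≤ u i) → (∀ j → + 0 ≤ v j) →
            ∀ {i j} → + 0 < u i → + 0 < Δ i j → + 0 < v j → + 0 < ⟨ u ∣ v ⟩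
  ⟨∣⟩-pos Δ≥0 {u} {v} u≥0 v≥0 {i} {j} ui>0 Δij>0 vj>0 =
    sum-pos _ (λ a → *-nonneg (u≥0 a) (Δv≥0 a)) i
      (*-pos ui>0 (sum-pos _ (λ b → *-nonneg (Δ≥0 i b) (v≥0 b)) j (*-pos Δij>0 vj>0)))
    where
    Δv≥0 : ∀ a → + 0 ≤ (Δ *ᵥ v) a
    Δv≥0 a = sum-nonneg _ (λ b → *-nonneg (Δ≥0 a b) (v≥0 b))

neighbourSum : ℕ → (ℕ → ℕ → ℕ) → (ℕ → ℤ) → ℕ → ℤ
neighbourSum r a w x = sum {r} (λ y → w (toℕ y) * + a (toℕ y) x)

record ChebyshevSequence (r : ℕ) (a : ℕ → ℕ → ℕ) (h : ℕ) : Set where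
  field
    term      : ℕ → ℕ → ℤ
    term-zero : ∀ {x} → x ℕ.< r → term 0 x ≡ + 0
    term-top  : ∀ {x} → x ℕ.< r → term h x ≡ + 0
    term-pos  : ∀ {k x} → 0 ℕ.< k → k ℕ.< h → x ℕ.< r → + 0 < term k x
    term-step : ∀ {k x} → 2 ℕ.+ k ℕ.≤ h → x ℕ.< r →
                term (2 ℕ.+ k) x ≡ neighbourSum r a (term (1 ℕ.+ k)) x - term k x

open ChebyshevSequence

ChebyshevSequence-≗ : ∀ {r a b h} → (∀ y x → a y x ≡ b y x) → ChebyshevSequence r a h → ChebyshevSequence r b h
ChebyshevSequence-≗ {r} a≗b S = record
  { term      = term S
  ; term-zero = term-zero S
  ; term-top  = term-top S
  ; term-pos  = term-pos S
  ; term-step = λ {k} {x} k+2≤h x<r →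
      trans (term-step S k+2≤h x<r)
            (cong (_- term S k x) (sum-cong-≗ {r} (λ y → cong (λ z → term S (suc k) (toℕ y) * + z) (a≗b (toℕ y) x))))
  }

adjacency : DynkinType → ℕ → ℕ → ℕ
adjacency t y x = if y ≡ᵇ x then 0 else negCartanOff t y x

≡ᵇ-refl : ∀ m → (m ≡ᵇ m) ≡ true
≡ᵇ-refl zero    = refl
≡ᵇ-refl (suc m) = ≡ᵇ-refl m

≡ᵇ-true⇒≡ : ∀ m n → (m ≡ᵇ n) ≡ true → m ≡ n
≡ᵇ-true⇒≡ m n eq = ℕₚ.≡ᵇ⇒≡ m n (subst T (sym eq) _)

≢⇒≡ᵇ-false : ∀ {m n} → m ≢ n → (m ≡ᵇ n) ≡ false
≢⇒≡ᵇ-false {m} {n} m≢n with m ≡ᵇ n in eq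
... | false = refl
... | true  = ⊥-elim (m≢n (≡ᵇ-true⇒≡ m n eq))

≡ᵇ-sym : ∀ m n → (m ≡ᵇ n) ≡ (n ≡ᵇ m)
≡ᵇ-sym zero    zero    = refl
≡ᵇ-sym zero    (suc n) = refl
≡ᵇ-sym (suc m) zero    = refl
≡ᵇ-sym (suc m) (suc n) = ≡ᵇ-sym m n

n≢1+n : ∀ n → n ≢ suc n
n≢1+n n = ℕₚ.<⇒≢ (ℕₚ.n<1+n n)

n≢2+n : ∀ n → n ≢ suc (suc n)
n≢2+n n = ℕₚ.<⇒≢ (ℕₚ.m≤n⇒m≤1+n (ℕₚ.n<1+n n))

2δ-cartan≡adjacency : ∀ t (p q : Fin (rank t)) → + 2 * δ p q - cartan t p q ≡ + adjacency t (toℕ p) (toℕ q)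
2δ-cartan≡adjacency t p q with p ≟ q
... | yes refl rewrite ≡ᵇ-refl (toℕ p) = refl
... | no p≢q rewrite ≢⇒≡ᵇ-false (p≢q ∘ Finₚ.toℕ-injective) =
  trans (ℤₚ.+-identityˡ _) (ℤₚ.neg-involutive _)

blockDiag-within : ∀ {k} (τ : Fin k → DynkinType) b (p q : Fin (rank (τ b))) →
                   blockDiag τ (b , p) (b , q) ≡ cartan (τ b) p q
blockDiag-within τ b p q with b ≟ b
... | yes refl = refl
... | no b≢b   = ⊥-elim (b≢b refl)

blockDiag-between : ∀ {k} (τ : Fin k → DynkinType) {b b′} (p : Fin (rank (τ b))) (q : Fin (rank (τ b′))) →
                    b ≢ b′ → blockDiag τ (b , p) (b′ , q) ≡ + 0
blockDiag-between τ {b} {b′} p q b≢b′ with b ≟ b′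
... | yes refl = ⊥-elim (b≢b′ refl)
... | no _     = refl

module Blocks {n} {Γ : Mat n} (d : Decomposition (cartanOf Γ)) where

  open Decomposition d

  Node : Set
  Node = Σ (Fin blocks) (λ b → Fin (rank (τ b)))

  to : Fin n → Node
  to = Inverse.to σ

  from : Node → Fin n
  from = Inverse.from σ

  block : Fin n → Fin blocks
  block i = proj₁ (to i)

  to-from : ∀ x → to (from x) ≡ x
  to-from = Inverse.strictlyInverseˡ σ

  block-from : ∀ K p → block (from (K , p)) ≡ K
  block-from K p = cong proj₁ (to-from (K , p))

  to-injective : ∀ {i j} → to i ≡ to j → i ≡ j
  to-injective {i} {j} eq =
    trans (sym (Inverse.strictlyInverseʳ σ i)) (trans (cong from eq) (Inverse.strictlyInverseʳ σ j))

  data BlockView (K : Fin blocks) (i : Fin n) : Set where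
    inside  : ∀ {p} → to i ≡ (K , p) → BlockView K i
    outside : block i ≢ K → BlockView K i

  blockView : ∀ K i → BlockView K i
  blockView K i with to i in eq
  ... | b , p with b ≟ K
  ...   | yes refl = inside eq
  ...   | no b≢K   = outside (λ e → b≢K (trans (sym (cong proj₁ eq)) e))

  δ-within : ∀ {i j b p q} → to i ≡ (b , p) → to j ≡ (b , q) → δ i j ≡ δ p q
  δ-within {i} {j} {b} {p} {q} eqi eqj with i ≟ j | p ≟ q
  ... | yes _    | yes _    = refl
  ... | no _     | no _     = refl
  ... | yes refl | no p≢q   = ⊥-elim (p≢q (,-injectiveʳ (trans (sym eqi) eqj)))
    where
    ,-injectiveʳ : ∀ {b} {p q : Fin (rank (τ b))} → (Node ∋ (b , p)) ≡ (b , q) → p ≡ q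
    ,-injectiveʳ refl = refl
  ... | no i≢j   | yes refl = ⊥-elim (i≢j (to-injective (trans eqi (sym eqj))))

  Γ≡2δ-blockDiag : ∀ i j → Γ i j ≡ + 2 * δ i j - blockDiag τ (to i) (to j)
  Γ≡2δ-blockDiag i j =
    trans (x≡y-[y-x] (Γ i j) (+ 2 * δ i j)) (cong (λ c → + 2 * δ i j - c) (entries i j))
    where
    x≡y-[y-x] : ∀ x y → x ≡ y - (y - x)
    x≡y-[y-x] = solve-∀

  Γ-between : ∀ {i j} → block i ≢ block j → Γ i j ≡ + 0
  Γ-between {i} {j} bi≢bj =
    trans (Γ≡2δ-blockDiag i j)
          (cong₂ (λ x y → + 2 * x - y) (δ-≢ (bi≢bj ∘ cong block))
                                       (blockDiag-between τ (proj₂ (to i)) (proj₂ (to j)) bi≢bj))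

  Γ-within : ∀ {i j b p q} → to i ≡ (b , p) → to j ≡ (b , q) → Γ i j ≡ + adjacency (τ b) (toℕ p) (toℕ q)
  Γ-within {i} {j} {b} {p} {q} eqi eqj = begin
    Γ i j                                     ≡⟨ Γ≡2δ-blockDiag i j ⟩
    + 2 * δ i j - blockDiag τ (to i) (to j)   ≡⟨ cong₂ (λ x y → + 2 * x - y) (δ-within eqi eqj)
                                                   (trans (cong₂ (blockDiag τ) eqi eqj) (blockDiag-within τ b p q)) ⟩
    + 2 * δ p q - cartan (τ b) p q            ≡⟨ 2δ-cartan≡adjacency (τ b) p q ⟩
    + adjacency (τ b) (toℕ p) (toℕ q)         ∎
    where open ≡-Reasoning

  Γ-nonneg : ∀ i j → + 0 ≤ Γ i j
  Γ-nonneg i j with blockView (block j) i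
  ... | inside eqi    = subst (+ 0 ≤_) (sym (Γ-within eqi refl)) (+≤+ z≤n)
  ... | outside bi≢bj = subst (+ 0 ≤_) (sym (Γ-between bi≢bj)) ℤₚ.≤-refl

  Γ-outside-column : ∀ {K i} p → block i ≢ K → Γ (from (K , p)) i ≡ + 0
  Γ-outside-column {K} {i} p i∉K = Γ-between {from (K , p)} {i} (λ e → i∉K (trans (sym e) (block-from K p)))

  Γ-outside-row : ∀ {K i} p → block i ≢ K → Γ i (from (K , p)) ≡ + 0
  Γ-outside-row {K} {i} p i∉K = Γ-between {i} {from (K , p)} (λ e → i∉K (trans e (block-from K p)))

  sum-over-block : ∀ K (F : Vector ℤ n) → (∀ l → block l ≢ K → F l ≡ + 0) →
                   sum F ≡ sum {rank (τ K)} (λ p → F (from (K , p)))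
  sum-over-block K F F-supported = begin
    sum F                                             ≡⟨ sum-cong-≗ expand ⟩
    sum (λ l → sum (λ p → δ (from (K , p)) l * F l))  ≡⟨ ∑-comm (λ l p → δ (from (K , p)) l * F l) ⟩
    sum (λ p → sum (λ l → δ (from (K , p)) l * F l))  ≡⟨ sum-cong-≗ (λ p → sum-δˡ (from (K , p)) F) ⟩
    sum (λ p → F (from (K , p)))                      ∎
    where
    open ≡-Reasoning
    expand : ∀ l → F l ≡ sum (λ p → δ (from (K , p)) l * F l)
    expand l with blockView K l
    ... | inside {q} eq =
      sym (trans (sum-cong-≗ (λ p → cong (_* F l) (δ-within (to-from (K , p)) eq))) (sum-δʳ q (λ _ → F l)))
    ... | outside l∉K =
      trans (F-supported l l∉K)
            (sym (sum-zero _ (λ p → trans (cong (δ (from (K , p)) l *_) (F-supported l l∉K))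
                                          (ℤₚ.*-zeroʳ (δ (from (K , p)) l)))))

  liftNode : Fin blocks → (ℕ → ℤ) → Node → ℤ
  liftNode K w (b , p) with b ≟ K
  ... | yes _ = w (toℕ p)
  ... | no _  = + 0

  lift : Fin blocks → (ℕ → ℤ) → Vector ℤ n
  lift K w i = liftNode K w (to i)

  lift-in : ∀ {K} w {i p} → to i ≡ (K , p) → lift K w i ≡ w (toℕ p)
  lift-in {K} w {p = p} eq = trans (cong (liftNode K w) eq) liftNode-in
    where
    liftNode-in : liftNode K w (K , p) ≡ w (toℕ p)
    liftNode-in with K ≟ K
    ... | yes _  = refl
    ... | no K≢K = ⊥-elim (K≢K refl)

  lift-out : ∀ {K} w {i} → block i ≢ K → lift K w i ≡ + 0
  lift-out {K} w {i} i∉K with block i ≟ K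
  ... | yes i∈K = ⊥-elim (i∉K i∈K)
  ... | no _    = refl

  lift-cong : ∀ K {w w′} → (∀ {x} → x ℕ.< rank (τ K) → w x ≡ w′ x) → lift K w ≗ lift K w′
  lift-cong K w≗w′ i with blockView K i
  ... | inside {p} eq = trans (lift-in _ eq) (trans (w≗w′ (Finₚ.toℕ<n p)) (sym (lift-in _ eq)))
  ... | outside i∉K   = trans (lift-out _ i∉K) (sym (lift-out _ i∉K))

  lift-zero : ∀ K → lift K (λ _ → + 0) ≗ (λ _ → + 0)
  lift-zero K i with blockView K i
  ... | inside eq   = lift-in _ eq
  ... | outside i∉K = lift-out _ i∉K

  lift-distrib-- : ∀ K w w′ → lift K (λ x → w x - w′ x) ≗ (λ i → lift K w i - lift K w′ i)
  lift-distrib-- K w w′ i with blockView K i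
  ... | inside eq   = trans (lift-in _ eq) (sym (cong₂ _-_ (lift-in w eq) (lift-in w′ eq)))
  ... | outside i∉K = trans (lift-out _ i∉K) (sym (cong₂ _-_ (lift-out w i∉K) (lift-out w′ i∉K)))

  lift-nonneg : ∀ K {w} → (∀ {x} → x ℕ.< rank (τ K) → + 0 ≤ w x) → ∀ i → + 0 ≤ lift K w i
  lift-nonneg K w≥0 i with blockView K i
  ... | inside {p} eq = subst (+ 0 ≤_) (sym (lift-in _ eq)) (w≥0 (Finₚ.toℕ<n p))
  ... | outside i∉K   = subst (+ 0 ≤_) (sym (lift-out _ i∉K)) ℤₚ.≤-refl

  sum-lift : ∀ K w (f : Vector ℤ n) →
             sum (λ l → lift K w l * f l) ≡ sum {rank (τ K)} (λ p → w (toℕ p) * f (from (K , p)))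
  sum-lift K w f =
    trans (sum-over-block K _ (λ l l∉K → trans (cong (_* f l) (lift-out w l∉K)) (ℤₚ.*-zeroˡ (f l))))
          (sum-cong-≗ (λ p → cong (_* f (from (K , p))) (lift-in w (to-from (K , p)))))

  lift-ᵥ* : ∀ K w → lift K w ᵥ* Γ ≗ lift K (neighbourSum (rank (τ K)) (adjacency (τ K)) w)
  lift-ᵥ* K w i = trans (sum-lift K w (λ l → Γ l i)) (restrict (blockView K i))
    where
    restrict : BlockView K i → sum (λ p → w (toℕ p) * Γ (from (K , p)) i) ≡
                               lift K (neighbourSum (rank (τ K)) (adjacency (τ K)) w) i
    restrict (inside eq) =
      trans (sum-cong-≗ (λ p → cong (w (toℕ p) *_) (Γ-within (to-from (K , p)) eq))) (sym (lift-in _ eq))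
    restrict (outside i∉K) =
      trans (sum-zero _ (λ p → trans (cong (w (toℕ p) *_) (Γ-outside-column p i∉K)) (ℤₚ.*-zeroʳ (w (toℕ p)))))
            (sym (lift-out _ i∉K))

  *ᵥ-lift : ∀ K w → Γ *ᵥ lift K w ≗ lift K (neighbourSum (rank (τ K)) (flip (adjacency (τ K))) w)
  *ᵥ-lift K w i =
    trans (sum-cong-≗ (λ l → ℤₚ.*-comm (Γ i l) (lift K w l)))
          (trans (sum-lift K w (Γ i)) (restrict (blockView K i)))
    where
    restrict : BlockView K i → sum (λ p → w (toℕ p) * Γ i (from (K , p))) ≡
                               lift K (neighbourSum (rank (τ K)) (flip (adjacency (τ K))) w) i
    restrict (inside eq) =
      trans (sum-cong-≗ (λ p → cong (w (toℕ p) *_) (Γ-within eq (to-from (K , p))))) (sym (lift-in _ eq))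
    restrict (outside i∉K) =
      trans (sum-zero _ (λ p → trans (cong (w (toℕ p) *_) (Γ-outside-row p i∉K)) (ℤₚ.*-zeroʳ (w (toℕ p)))))
            (sym (lift-out _ i∉K))

  lift-chebyshev : ∀ {K a h} (Φ : Vector ℤ n → Vector ℤ n) →
                   (∀ {v w} → v ≗ w → Φ v ≗ Φ w) →
                   (∀ w → Φ (lift K w) ≗ lift K (neighbourSum (rank (τ K)) a w)) →
                   (S : ChebyshevSequence (rank (τ K)) a h) → ∀ {k} → k ℕ.≤ h →
                   lift K (term S k) ≗ chebyshev Φ (lift K (term S 1)) k
  lift-chebyshev {K} Φ Φ-cong Φ-lift S {zero} k≤h i =
    trans (lift-cong K (term-zero S) i) (lift-zero K i)
  lift-chebyshev {K} Φ Φ-cong Φ-lift S {suc zero} k≤h i = refl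
  lift-chebyshev {K} {a} Φ Φ-cong Φ-lift S {suc (suc k)} k+2≤h i = begin
    lift K (term S (2 ℕ.+ k)) i
      ≡⟨ lift-cong K (term-step S k+2≤h) i ⟩
    lift K (λ x → neighbourSum (rank (τ K)) a (term S (1 ℕ.+ k)) x - term S k x) i
      ≡⟨ lift-distrib-- K _ (term S k) i ⟩
    lift K (neighbourSum (rank (τ K)) a (term S (1 ℕ.+ k))) i - lift K (term S k) i
      ≡⟨ cong₂ _-_ (sym (Φ-lift (term S (1 ℕ.+ k)) i))
                   (lift-chebyshev Φ Φ-cong Φ-lift S (ℕₚ.≤-trans (ℕₚ.n≤1+n k) k+1≤h) i) ⟩
    Φ (lift K (term S (1 ℕ.+ k))) i - chebyshev Φ (lift K (term S 1)) k i
      ≡⟨ cong (_- chebyshev Φ (lift K (term S 1)) k i) (Φ-cong (lift-chebyshev Φ Φ-cong Φ-lift S k+1≤h) i) ⟩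
    chebyshev Φ (lift K (term S 1)) (2 ℕ.+ k) i ∎
    where
    open ≡-Reasoning
    k+1≤h = ℕₚ.≤-trans (ℕₚ.n≤1+n (suc k)) k+2≤h

∣_∣ᶻ : ℤ → ℤ
∣ z ∣ᶻ = + ℤ.∣ z ∣

∣-∣ᶻ : ∀ z → ∣ - z ∣ᶻ ≡ ∣ z ∣ᶻ
∣-∣ᶻ z = cong +_ (ℤₚ.∣-i∣≡∣i∣ z)

z≤∣z∣ᶻ : ∀ z → z ≤ ∣ z ∣ᶻ
z≤∣z∣ᶻ (+ n)      = ℤₚ.≤-refl
z≤∣z∣ᶻ ℤ.-[1+ n ] = ℤ.-≤+

-z≤∣z∣ᶻ : ∀ z → - z ≤ ∣ z ∣ᶻ
-z≤∣z∣ᶻ z = subst (- z ≤_) (∣-∣ᶻ z) (z≤∣z∣ᶻ (- z))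

∣∣ᶻ-≤ : ∀ a {c} → a ≤ c → - a ≤ c → ∣ a ∣ᶻ ≤ c
∣∣ᶻ-≤ a a≤c -a≤c with ℤₚ.+∣i∣≡i⊎+∣i∣≡-i a
... | inj₁ eq = subst (_≤ _) (sym eq) a≤c
... | inj₂ eq = subst (_≤ _) (sym eq) -a≤c

∣∣ᶻ+∣∣ᶻ-≤ : ∀ a b {c} → ∣ a + b ∣ᶻ ≤ c → ∣ a - b ∣ᶻ ≤ c → ∣ a ∣ᶻ + ∣ b ∣ᶻ ≤ c
∣∣ᶻ+∣∣ᶻ-≤ a b ∣a+b∣≤c ∣a-b∣≤c
  with ℤₚ.+∣i∣≡i⊎+∣i∣≡-i a | ℤₚ.+∣i∣≡i⊎+∣i∣≡-i b
... | inj₁ ea | inj₁ eb =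
  subst (_≤ _) (sym (cong₂ _+_ ea eb)) (ℤₚ.≤-trans (z≤∣z∣ᶻ (a + b)) ∣a+b∣≤c)
... | inj₁ ea | inj₂ eb =
  subst (_≤ _) (sym (cong₂ _+_ ea eb)) (ℤₚ.≤-trans (z≤∣z∣ᶻ (a - b)) ∣a-b∣≤c)
... | inj₂ ea | inj₁ eb =
  subst (_≤ _) (trans (-[a-b]≡-a+b a b) (sym (cong₂ _+_ ea eb))) (ℤₚ.≤-trans (-z≤∣z∣ᶻ (a - b)) ∣a-b∣≤c)
  where
  -[a-b]≡-a+b : ∀ a b → - (a - b) ≡ - a + b
  -[a-b]≡-a+b = solve-∀
... | inj₂ ea | inj₂ eb =
  subst (_≤ _) (trans (-[a+b]≡-a-b a b) (sym (cong₂ _+_ ea eb))) (ℤₚ.≤-trans (-z≤∣z∣ᶻ (a + b)) ∣a+b∣≤c)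
  where
  -[a+b]≡-a-b : ∀ a b → - (a + b) ≡ - a + - b
  -[a+b]≡-a-b = solve-∀

≤-by-difference : ∀ {a c} n → c - a ≡ + n → a ≤ c
≤-by-difference n eq = ℤₚ.0≤i-j⇒j≤i (subst (+ 0 ≤_) (sym eq) (+≤+ z≤n))

-- tent N u v = 2 min(u, N - u, v, N - v) for 0 ≤ u, v ≤ N
tent : ℤ → ℤ → ℤ → ℤ
tent N u v = N - ∣ u + v - N ∣ᶻ - ∣ u - v ∣ᶻ

tent-via : ∀ N u v {a b} → u + v - N ≡ a → u - v ≡ b → tent N u v ≡ N - ∣ a ∣ᶻ - ∣ b ∣ᶻ
tent-via N u v refl refl = refl

tent-wave : ∀ N u v →
  tent N u (+ 1 + v) + tent N (+ 1 + (+ 1 + u)) (+ 1 + v) - tent N (+ 1 + u) v ≡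
  tent N (+ 1 + u) (+ 1 + (+ 1 + v))
tent-wave N u v = begin
  tent N u (+ 1 + v) + tent N (+ 1 + (+ 1 + u)) (+ 1 + v) - tent N (+ 1 + u) v
    ≡⟨ cong₂ _-_ (cong₂ _+_ (tent-via N u (+ 1 + v) (e₁ N u v) (e₂ u v))
                            (tent-via N (+ 1 + (+ 1 + u)) (+ 1 + v) (e₃ N u v) (e₄ u v)))
                 (tent-via N (+ 1 + u) v (e₅ N u v) (e₆ u v)) ⟩
  (N - ∣ a ∣ᶻ - ∣ b ∣ᶻ) + (N - ∣ c ∣ᶻ - ∣ d ∣ᶻ) - (N - ∣ a ∣ᶻ - ∣ d ∣ᶻ)
    ≡⟨ cancel N ∣ a ∣ᶻ ∣ b ∣ᶻ ∣ c ∣ᶻ ∣ d ∣ᶻ ⟩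
  N - ∣ c ∣ᶻ - ∣ b ∣ᶻ
    ≡⟨ sym (tent-via N (+ 1 + u) (+ 1 + (+ 1 + v)) (e₇ N u v) (e₈ u v)) ⟩
  tent N (+ 1 + u) (+ 1 + (+ 1 + v)) ∎
  where
  open ≡-Reasoning
  a = u + v + + 1 - N
  b = u - v - + 1
  c = u + v + + 3 - N
  d = u - v + + 1
  e₁ : ∀ N u v → u + (+ 1 + v) - N ≡ u + v + + 1 - N
  e₁ = solve-∀
  e₂ : ∀ u v → u - (+ 1 + v) ≡ u - v - + 1
  e₂ = solve-∀
  e₃ : ∀ N u v → + 1 + (+ 1 + u) + (+ 1 + v) - N ≡ u + v + + 3 - N
  e₃ = solve-∀
  e₄ : ∀ u v → + 1 + (+ 1 + u) - (+ 1 + v) ≡ u - v + + 1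
  e₄ = solve-∀
  e₅ : ∀ N u v → + 1 + u + v - N ≡ u + v + + 1 - N
  e₅ = solve-∀
  e₆ : ∀ u v → + 1 + u - v ≡ u - v + + 1
  e₆ = solve-∀
  e₇ : ∀ N u v → + 1 + u + (+ 1 + (+ 1 + v)) - N ≡ u + v + + 3 - N
  e₇ = solve-∀
  e₈ : ∀ u v → + 1 + u - (+ 1 + (+ 1 + v)) ≡ u - v - + 1
  e₈ = solve-∀
  cancel : ∀ N A B C D → (N - A - B) + (N - C - D) - (N - A - D) ≡ N - C - B
  cancel = solve-∀

tent-swap : ∀ N u v → tent N u v ≡ tent N v u
tent-swap N u v =
  cong₂ (λ x y → N - ∣ x ∣ᶻ - y) (e N u v) (sym (trans (cong ∣_∣ᶻ (e′ u v)) (∣-∣ᶻ (u - v))))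
  where
  e : ∀ N u v → u + v - N ≡ v + u - N
  e = solve-∀
  e′ : ∀ u v → v - u ≡ - (u - v)
  e′ = solve-∀

tent-reflect : ∀ N u v → tent N (N - u) v ≡ tent N u v
tent-reflect N u v = begin
  tent N (N - u) v                  ≡⟨ tent-via N (N - u) v (e₁ N u v) (e₂ N u v) ⟩
  N - ∣ - (u - v) ∣ᶻ - ∣ - (u + v - N) ∣ᶻ
    ≡⟨ cong₂ (λ x y → N - x - y) (∣-∣ᶻ (u - v)) (∣-∣ᶻ (u + v - N)) ⟩
  N - ∣ u - v ∣ᶻ - ∣ u + v - N ∣ᶻ  ≡⟨ swap N ∣ u - v ∣ᶻ ∣ u + v - N ∣ᶻ ⟩
  tent N u v                        ∎
  where
  open ≡-Reasoning
  e₁ : ∀ N u v → N - u + v - N ≡ - (u - v)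
  e₁ = solve-∀
  e₂ : ∀ N u v → N - u - v ≡ - (u + v - N)
  e₂ = solve-∀
  swap : ∀ N A B → N - A - B ≡ N - B - A
  swap = solve-∀

tent-zero : ∀ {N v} → v ℕ.≤ N → tent (+ N) (+ 0) (+ v) ≡ + 0
tent-zero {N} {v} v≤N = begin
  tent (+ N) (+ 0) (+ v)               ≡⟨ tent-via (+ N) (+ 0) (+ v) (e₁ (+ N) (+ v)) (e₂ (+ v)) ⟩
  + N - ∣ - (+ N - + v) ∣ᶻ - ∣ - + v ∣ᶻ
    ≡⟨ cong₂ (λ x y → + N - x - y) (trans (∣-∣ᶻ (+ N - + v)) N-v) (∣-∣ᶻ (+ v)) ⟩
  + N - (+ N - + v) - + v              ≡⟨ e₃ (+ N) (+ v) ⟩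
  + 0                                  ∎
  where
  open ≡-Reasoning
  e₁ : ∀ N v → + 0 + v - N ≡ - (N - v)
  e₁ = solve-∀
  e₂ : ∀ v → + 0 - v ≡ - v
  e₂ = solve-∀
  e₃ : ∀ N v → N - (N - v) - v ≡ + 0
  e₃ = solve-∀
  N-v : ∣ + N - + v ∣ᶻ ≡ + N - + v
  N-v = ℤₚ.0≤i⇒+∣i∣≡i (ℤₚ.i≤j⇒0≤j-i (+≤+ v≤N))

tent-vanishes-right : ∀ {N v} → v ℕ.≤ N → tent (+ N) (+ N) (+ v) ≡ + 0
tent-vanishes-right {N} {v} v≤N =
  trans (cong (λ u → tent (+ N) u (+ v)) (sym (ℤₚ.+-identityʳ (+ N))))
        (trans (tent-reflect (+ N) (+ 0) (+ v)) (tent-zero v≤N))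

tent-vanishes-bottom : ∀ {N u} → u ℕ.≤ N → tent (+ N) (+ u) (+ 0) ≡ + 0
tent-vanishes-bottom {N} {u} u≤N = trans (tent-swap (+ N) (+ u) (+ 0)) (tent-zero u≤N)

tent-vanishes-top : ∀ {N u} → u ℕ.≤ N → tent (+ N) (+ u) (+ N) ≡ + 0
tent-vanishes-top {N} {u} u≤N = trans (tent-swap (+ N) (+ u) (+ N)) (tent-vanishes-right u≤N)

∣2u-N∣≤N-2 : ∀ {u N} → 0 ℕ.< u → u ℕ.< N → ∣ + u + + u - + N ∣ᶻ ≤ + N - + 2
∣2u-N∣≤N-2 {suc i} (s≤s z≤n) u<N with ℕₚ.m≤n⇒∃[o]m+o≡n u<N
... | s , refl = ∣∣ᶻ-≤ (+ 1 + + i + (+ 1 + + i) - (+ 2 + + i + + s))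
                      (≤-by-difference (s ℕ.+ s) (e₁ (+ i) (+ s))) (≤-by-difference (i ℕ.+ i) (e₂ (+ i) (+ s)))
  where
  e₁ : ∀ i s → + 2 + i + s - + 2 - (+ 1 + i + (+ 1 + i) - (+ 2 + i + s)) ≡ s + s
  e₁ = solve-∀
  e₂ : ∀ i s → + 2 + i + s - + 2 - - (+ 1 + i + (+ 1 + i) - (+ 2 + i + s)) ≡ i + i
  e₂ = solve-∀

0<2+ : ∀ {x} → + 0 ≤ x → + 0 < + 2 + x
0<2+ {+ n} _ = +<+ (s≤s z≤n)

tent-pos : ∀ {N u v} → 0 ℕ.< u → u ℕ.< N → 0 ℕ.< v → v ℕ.< N → + 0 < tent (+ N) (+ u) (+ v)
tent-pos {N} {u} {v} 0<u u<N 0<v v<N =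
  subst (+ 0 <_) (sym (e (+ N) ∣ a ∣ᶻ ∣ b ∣ᶻ))
        (0<2+ (ℤₚ.i≤j⇒0≤j-i (∣∣ᶻ+∣∣ᶻ-≤ a b ∣a+b∣≤ ∣a-b∣≤)))
  where
  a = + u + + v - + N
  b = + u - + v
  e : ∀ N A B → N - A - B ≡ + 2 + (N - + 2 - (A + B))
  e = solve-∀
  a+b≡2u-N : ∀ u v N → u + v - N + (u - v) ≡ u + u - N
  a+b≡2u-N = solve-∀
  a-b≡2v-N : ∀ u v N → u + v - N - (u - v) ≡ v + v - N
  a-b≡2v-N = solve-∀
  ∣a+b∣≤ : ∣ a + b ∣ᶻ ≤ + N - + 2
  ∣a+b∣≤ = subst (λ z → ∣ z ∣ᶻ ≤ _) (sym (a+b≡2u-N (+ u) (+ v) (+ N))) (∣2u-N∣≤N-2 0<u u<N)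
  ∣a-b∣≤ : ∣ a - b ∣ᶻ ≤ + N - + 2
  ∣a-b∣≤ = subst (λ z → ∣ z ∣ᶻ ≤ _) (sym (a-b≡2v-N (+ u) (+ v) (+ N))) (∣2u-N∣≤N-2 0<v v<N)

-- half c v = min(v, 2c - v) for 0 ≤ v ≤ 2c
half : ℤ → ℤ → ℤ
half c v = c - ∣ v - c ∣ᶻ

tent-center : ∀ c v → tent (c + c) c v ≡ half c v + half c v
tent-center c v = begin
  tent (c + c) c v                          ≡⟨ tent-via (c + c) c v (e₁ c v) (e₂ c v) ⟩
  c + c - ∣ v - c ∣ᶻ - ∣ - (v - c) ∣ᶻ       ≡⟨ cong (λ x → c + c - ∣ v - c ∣ᶻ - x) (∣-∣ᶻ (v - c)) ⟩
  c + c - ∣ v - c ∣ᶻ - ∣ v - c ∣ᶻ           ≡⟨ e₃ c ∣ v - c ∣ᶻ ⟩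
  half c v + half c v                       ∎
  where
  open ≡-Reasoning
  e₁ : ∀ c v → c + v - (c + c) ≡ v - c
  e₁ = solve-∀
  e₂ : ∀ c v → c - v ≡ - (v - c)
  e₂ = solve-∀
  e₃ : ∀ c A → c + c - A - A ≡ c - A + (c - A)
  e₃ = solve-∀

half-wave : ∀ u v →
  half (+ 1 + u) (+ 1 + (+ 1 + v)) + half (+ 1 + u) v ≡ tent (+ 1 + u + (+ 1 + u)) u (+ 1 + v)
half-wave u v = begin
  half (+ 1 + u) (+ 1 + (+ 1 + v)) + half (+ 1 + u) v
    ≡⟨ cong₂ (λ x y → (+ 1 + u - ∣ x ∣ᶻ) + (+ 1 + u - ∣ y ∣ᶻ)) (e₁ u v) (e₂ u v) ⟩
  (+ 1 + u - ∣ - (u - v - + 1) ∣ᶻ) + (+ 1 + u - ∣ v - u - + 1 ∣ᶻ)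
    ≡⟨ cong (λ x → (+ 1 + u - x) + (+ 1 + u - ∣ v - u - + 1 ∣ᶻ)) (∣-∣ᶻ (u - v - + 1)) ⟩
  (+ 1 + u - ∣ u - v - + 1 ∣ᶻ) + (+ 1 + u - ∣ v - u - + 1 ∣ᶻ)
    ≡⟨ e₃ u ∣ u - v - + 1 ∣ᶻ ∣ v - u - + 1 ∣ᶻ ⟩
  + 1 + u + (+ 1 + u) - ∣ v - u - + 1 ∣ᶻ - ∣ u - v - + 1 ∣ᶻ
    ≡⟨ sym (tent-via (+ 1 + u + (+ 1 + u)) u (+ 1 + v) (e₄ u v) (e₅ u v)) ⟩
  tent (+ 1 + u + (+ 1 + u)) u (+ 1 + v) ∎
  where
  open ≡-Reasoning
  e₁ : ∀ u v → + 1 + (+ 1 + v) - (+ 1 + u) ≡ - (u - v - + 1)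
  e₁ = solve-∀
  e₂ : ∀ u v → v - (+ 1 + u) ≡ v - u - + 1
  e₂ = solve-∀
  e₃ : ∀ u A B → (+ 1 + u - A) + (+ 1 + u - B) ≡ + 1 + u + (+ 1 + u) - B - A
  e₃ = solve-∀
  e₄ : ∀ u v → u + (+ 1 + v) - (+ 1 + u + (+ 1 + u)) ≡ v - u - + 1
  e₄ = solve-∀
  e₅ : ∀ u v → u - (+ 1 + v) ≡ u - v - + 1
  e₅ = solve-∀

half-zero : ∀ c → half (+ c) (+ 0) ≡ + 0
half-zero c =
  trans (cong (λ x → + c - ∣ x ∣ᶻ) (ℤₚ.+-identityˡ (- + c)))
        (trans (cong (λ x → + c - x) (∣-∣ᶻ (+ c))) (ℤₚ.+-inverseʳ (+ c)))

half-top : ∀ c → half (+ c) (+ c + + c) ≡ + 0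
half-top c = trans (cong (λ x → + c - ∣ x ∣ᶻ) (e (+ c))) (ℤₚ.+-inverseʳ (+ c))
  where
  e : ∀ c → c + c - c ≡ c
  e = solve-∀

half-pos : ∀ {c v} → 0 ℕ.< v → v ℕ.< c ℕ.+ c → + 0 < half (+ c) (+ v)
half-pos {c} {suc j} (s≤s z≤n) v<2c with ℕₚ.m≤n⇒∃[o]m+o≡n v<2c
... | t , 2+j+t≡2c =
  subst (+ 0 <_) (sym (e (+ c) ∣ x ∣ᶻ)) (0<1+ (ℤₚ.i≤j⇒0≤j-i (∣∣ᶻ-≤ x x≤c-1 -x≤c-1)))
  where
  x = + 1 + + j - + c
  e : ∀ c A → c - A ≡ + 1 + (c - + 1 - A)
  e = solve-∀
  0<1+ : ∀ {y} → + 0 ≤ y → + 0 < + 1 + y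
  0<1+ {+ n} _ = +<+ (s≤s z≤n)
  e₁ : ∀ c j → c - + 1 - (+ 1 + j - c) ≡ c + c - (+ 2 + j)
  e₁ = solve-∀
  e₂ : ∀ j t → + 2 + j + t - (+ 2 + j) ≡ t
  e₂ = solve-∀
  x≤c-1 : x ≤ + c - + 1
  x≤c-1 = ≤-by-difference t (trans (e₁ (+ c) (+ j))
                                   (trans (cong (λ y → y - (+ 2 + + j)) (cong +_ (sym 2+j+t≡2c))) (e₂ (+ j) (+ t))))
  e₃ : ∀ c j → c - + 1 - - (+ 1 + j - c) ≡ j
  e₃ = solve-∀
  -x≤c-1 : - x ≤ + c - + 1
  -x≤c-1 = ≤-by-difference j (e₃ (+ c) (+ j))

ι : Bool → ℤ
ι true  = + 1
ι false = + 0

sum-point-in : ∀ {r p} (g : ℕ → ℤ) → p ℕ.< r → sum {r} (λ y → g (toℕ y) * ι (toℕ y ≡ᵇ p)) ≡ g p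
sum-point-in {suc r} {zero} g _ =
  trans (cong₂ _+_ (ℤₚ.*-identityʳ (g 0)) (sum-zero {r} _ (λ y → ℤₚ.*-zeroʳ (g (suc (toℕ y))))))
        (ℤₚ.+-identityʳ (g 0))
sum-point-in {suc r} {suc p} g (s≤s p<r) =
  trans (cong₂ _+_ (ℤₚ.*-zeroʳ (g 0)) (sum-point-in (g ∘ suc) p<r)) (ℤₚ.+-identityˡ _)

sum-point-out : ∀ {r p} (g : ℕ → ℤ) → r ℕ.≤ p → sum {r} (λ y → g (toℕ y) * ι (toℕ y ≡ᵇ p)) ≡ + 0
sum-point-out {zero}  g _ = refl
sum-point-out {suc r} {suc p} g (s≤s r≤p) =
  trans (cong₂ _+_ (ℤₚ.*-zeroʳ (g 0)) (sum-point-out (g ∘ suc) r≤p)) (ℤₚ.+-identityˡ _)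

sum-two-points : ∀ {r} (g : ℕ → ℤ) p q →
  sum {r} (λ y → g (toℕ y) * (ι (toℕ y ≡ᵇ p) + ι (toℕ y ≡ᵇ q))) ≡
  sum {r} (λ y → g (toℕ y) * ι (toℕ y ≡ᵇ p)) + sum {r} (λ y → g (toℕ y) * ι (toℕ y ≡ᵇ q))
sum-two-points {r} g p q =
  trans (sum-cong-≗ {r} (λ y → ℤₚ.*-distribˡ-+ (g (toℕ y)) (ι (toℕ y ≡ᵇ p)) (ι (toℕ y ≡ᵇ q))))
        (∑-distrib-+ {r} (λ y → g (toℕ y) * ι (toℕ y ≡ᵇ p)) (λ y → g (toℕ y) * ι (toℕ y ≡ᵇ q)))

neighbourSum-≗ : ∀ {r a x} (e : ℕ → ℤ) → (∀ y → + a y x ≡ e y) → ∀ g →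
                 neighbourSum r a g x ≡ sum {r} (λ y → g (toℕ y) * e (toℕ y))
neighbourSum-≗ {r} e a≗e g = sum-cong-≗ {r} (λ y → cong (g (toℕ y) *_) (a≗e (toℕ y)))

neighbourSum-split : ∀ {r a b x} (e : ℕ → ℤ) → (∀ y → + a y x ≡ + b y x + e y) → ∀ g →
                     neighbourSum r a g x ≡ neighbourSum r b g x + sum {r} (λ y → g (toℕ y) * e (toℕ y))
neighbourSum-split {r} {a} {b} {x} e a≗b+e g =
  trans (neighbourSum-≗ {r} {a} {x} _ a≗b+e g)
        (trans (sum-cong-≗ {r} (λ y → ℤₚ.*-distribˡ-+ (g (toℕ y)) (+ b (toℕ y) x) (e (toℕ y))))
               (∑-distrib-+ {r} (λ y → g (toℕ y) * + b (toℕ y) x) (λ y → g (toℕ y) * e (toℕ y))))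

chain-zero : ∀ y → + chain y 0 ≡ ι (y ≡ᵇ 1)
chain-zero zero          = refl
chain-zero (suc zero)    = refl
chain-zero (suc (suc y)) = refl

chain-suc : ∀ y x → + chain y (suc x) ≡ ι (y ≡ᵇ x) + ι (y ≡ᵇ suc (suc x))
chain-suc zero          zero          = refl
chain-suc zero          (suc zero)    = refl
chain-suc zero          (suc (suc x)) = refl
chain-suc (suc y)       zero          = trans (chain-zero y) (sym (ℤₚ.+-identityˡ _))
chain-suc (suc y)       (suc x)       = chain-suc y x

chain-sym : ∀ y x → chain y x ≡ chain x y
chain-sym zero          zero          = refl
chain-sym zero          (suc zero)    = refl
chain-sym zero          (suc (suc x)) = refl
chain-sym (suc zero)    zero          = refl
chain-sym (suc (suc y)) zero          = refl
chain-sym (suc y)       (suc x)       = chain-sym y x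

chain-diag : ∀ x → chain x x ≡ 0
chain-diag zero    = refl
chain-diag (suc x) = chain-diag x

chain-1+n : ∀ n → chain (suc n) n ≡ 1
chain-1+n n rewrite ≡ᵇ-refl n = cong (λ b → if b then 1 else 0) (Boolₚ.∨-zeroʳ (suc (suc n) ≡ᵇ n))

chain-far : ∀ y x → suc (suc x) ℕ.≤ y → chain y x ≡ 0
chain-far (suc (suc y)) zero    _         = refl
chain-far (suc y)       (suc x) (s≤s x+2≤y) = chain-far y x x+2≤y

leftNeighbour : (ℕ → ℤ) → ℕ → ℤ
leftNeighbour g zero    = + 0
leftNeighbour g (suc x) = g x

neighbourSum-chain : ∀ {r x} g → suc x ℕ.< r →
                     neighbourSum r chain g x ≡ leftNeighbour g x + g (suc x)
neighbourSum-chain {r} {zero} g 1<r =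
  trans (neighbourSum-≗ {r} {chain} {0} _ chain-zero g) (trans (sum-point-in g 1<r) (sym (ℤₚ.+-identityˡ _)))
neighbourSum-chain {r} {suc x} g x+2<r =
  trans (neighbourSum-≗ {r} {chain} {suc x} _ (λ y → chain-suc y x) g)
        (trans (sum-two-points {r} g x (suc (suc x)))
               (cong₂ _+_ (sum-point-in g (ℕₚ.<-trans (ℕₚ.n<1+n x) (ℕₚ.<-trans (ℕₚ.n<1+n (suc x)) x+2<r)))
                          (sum-point-in g x+2<r)))

neighbourSum-chain-last : ∀ {x} g → neighbourSum (suc x) chain g x ≡ leftNeighbour g x
neighbourSum-chain-last {zero} g = trans (neighbourSum-≗ {1} {chain} {0} _ chain-zero g) (sum-point-out {1} g ℕₚ.≤-refl)
neighbourSum-chain-last {suc x} g =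
  trans (neighbourSum-≗ {suc (suc x)} {chain} {suc x} _ (λ y → chain-suc y x) g)
        (trans (sum-two-points {suc (suc x)} g x (suc (suc x)))
               (trans (cong₂ _+_ (sum-point-in {suc (suc x)} g (ℕₚ.<-trans (ℕₚ.n<1+n x) (ℕₚ.n<1+n (suc x))))
                                 (sum-point-out {suc (suc x)} g ℕₚ.≤-refl))
                      (ℤₚ.+-identityʳ (g x))))

adjacency-A : ∀ m y x → adjacency (A m) y x ≡ chain y x
adjacency-A m y x with y ≡ᵇ x in y≡x
... | true  rewrite ≡ᵇ-true⇒≡ y x y≡x = sym (chain-diag x)
... | false = refl

adjacency-A-sym : ∀ m y x → adjacency (A m) y x ≡ adjacency (A m) x y
adjacency-A-sym m y x = trans (adjacency-A m y x) (trans (chain-sym y x) (sym (adjacency-A m x y)))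

≡ᵇ∧≡ᵇ-suc≡false : ∀ x m → ((x ≡ᵇ m) ∧ (x ≡ᵇ suc m)) ≡ false
≡ᵇ∧≡ᵇ-suc≡false x m with x ≡ᵇ m in x≡m
... | false = refl
... | true rewrite ≡ᵇ-true⇒≡ x m x≡m = ≢⇒≡ᵇ-false (n≢1+n m)

adjacency-B : ∀ m y x → + adjacency (B m) y x ≡ + chain y x + ι ((x ≡ᵇ m) ∧ (y ≡ᵇ suc m))
adjacency-B m y x with y ≡ᵇ x in y≡x
... | true rewrite ≡ᵇ-true⇒≡ y x y≡x | chain-diag x | ≡ᵇ∧≡ᵇ-suc≡false x m = refl
... | false with x ≡ᵇ m in x≡m | y ≡ᵇ suc m in y≡1+m
...   | true  | true  rewrite ≡ᵇ-true⇒≡ x m x≡m | ≡ᵇ-true⇒≡ y (suc m) y≡1+m | chain-1+n m = refl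
...   | true  | false = sym (ℤₚ.+-identityʳ _)
...   | false | b     rewrite Boolₚ.∧-zeroʳ b = sym (ℤₚ.+-identityʳ _)

adjacency-Bᵀ : ∀ m y x → + adjacency (B m) x y ≡ + chain y x + ι ((x ≡ᵇ suc m) ∧ (y ≡ᵇ m))
adjacency-Bᵀ m y x =
  trans (adjacency-B m x y)
        (cong₂ _+_ (cong +_ (chain-sym x y)) (cong ι (Boolₚ.∧-comm (y ≡ᵇ m) (x ≡ᵇ suc m))))

adjacency-C : ∀ m y x → adjacency (C m) y x ≡ adjacency (B (suc m)) x y
adjacency-C m y x
  rewrite ≡ᵇ-sym y x | Boolₚ.∧-comm (y ≡ᵇ suc m) (x ≡ᵇ suc (suc m)) | chain-sym y x = refl

adjacency-D-sym : ∀ m y x → adjacency (D m) y x ≡ adjacency (D m) x y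
adjacency-D-sym m y x
  rewrite ≡ᵇ-sym y x
        | Boolₚ.∨-comm ((y ≡ᵇ 3 ℕ.+ m) ∧ (x ≡ᵇ 1 ℕ.+ m)) ((x ≡ᵇ 3 ℕ.+ m) ∧ (y ≡ᵇ 1 ℕ.+ m))
        | Boolₚ.∨-comm (y ≡ᵇ 3 ℕ.+ m) (x ≡ᵇ 3 ℕ.+ m)
        | chain-sym y x = refl

adjacency-D-path : ∀ m y x → x ℕ.≤ m → adjacency (D m) y x ≡ chain y x
adjacency-D-path m y x x≤m
  rewrite ≢⇒≡ᵇ-false (ℕₚ.<⇒≢ (s≤s x≤m))
        | ≢⇒≡ᵇ-false (ℕₚ.<⇒≢ (s≤s (ℕₚ.m≤n⇒m≤1+n (ℕₚ.m≤n⇒m≤1+n x≤m))))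
        | Boolₚ.∧-zeroʳ (y ≡ᵇ 3 ℕ.+ m) | Boolₚ.∨-identityʳ (y ≡ᵇ 3 ℕ.+ m)
  with y ≡ᵇ x in y≡x | y ≡ᵇ 3 ℕ.+ m in y≡3+m
... | true  | _     rewrite ≡ᵇ-true⇒≡ y x y≡x = sym (chain-diag x)
... | false | true  rewrite ≡ᵇ-true⇒≡ y (3 ℕ.+ m) y≡3+m =
  sym (chain-far (3 ℕ.+ m) x (s≤s (s≤s (ℕₚ.m≤n⇒m≤1+n x≤m))))
... | false | false = refl

adjacency-D-fork : ∀ m y → + adjacency (D m) y (suc m) ≡ + chain y (suc m) + ι (y ≡ᵇ 3 ℕ.+ m)
adjacency-D-fork m y
  rewrite ≢⇒≡ᵇ-false {suc m} {3 ℕ.+ m} (n≢2+n (suc m))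
        | ≡ᵇ-refl m | Boolₚ.∧-identityʳ (y ≡ᵇ 3 ℕ.+ m) | Boolₚ.∨-identityʳ (y ≡ᵇ 3 ℕ.+ m)
  with y ≡ᵇ suc m in y≡1+m
... | true rewrite ≡ᵇ-true⇒≡ y (suc m) y≡1+m | chain-diag m
                 | ≢⇒≡ᵇ-false {suc m} {3 ℕ.+ m} (n≢2+n (suc m)) = refl
... | false with y ≡ᵇ 3 ℕ.+ m in y≡3+m
...   | true  rewrite ≡ᵇ-true⇒≡ y (3 ℕ.+ m) y≡3+m | chain-far (3 ℕ.+ m) (suc m) ℕₚ.≤-refl = refl
...   | false = sym (ℤₚ.+-identityʳ _)

adjacency-D-end₁ : ∀ m y → + adjacency (D m) y (2 ℕ.+ m) ≡ ι (y ≡ᵇ suc m)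
adjacency-D-end₁ m y
  rewrite ≢⇒≡ᵇ-false {2 ℕ.+ m} {1 ℕ.+ m} (n≢1+n (suc m) ∘ sym)
        | ≢⇒≡ᵇ-false {2 ℕ.+ m} {3 ℕ.+ m} (n≢1+n (2 ℕ.+ m))
        | Boolₚ.∧-zeroʳ (y ≡ᵇ 3 ℕ.+ m) | Boolₚ.∨-identityʳ (y ≡ᵇ 3 ℕ.+ m)
  with y ≡ᵇ 2 ℕ.+ m in y≡2+m
... | true rewrite ≡ᵇ-true⇒≡ y (2 ℕ.+ m) y≡2+m
                 | ≢⇒≡ᵇ-false {2 ℕ.+ m} {1 ℕ.+ m} (n≢1+n (suc m) ∘ sym) = refl
... | false with y ≡ᵇ 3 ℕ.+ m in y≡3+m
...   | true rewrite ≡ᵇ-true⇒≡ y (3 ℕ.+ m) y≡3+m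
                   | ≢⇒≡ᵇ-false {3 ℕ.+ m} {1 ℕ.+ m} (n≢2+n (suc m) ∘ sym) = refl
...   | false rewrite chain-suc y (suc m) | y≡3+m = ℤₚ.+-identityʳ _

adjacency-D-end₂ : ∀ m y → + adjacency (D m) y (3 ℕ.+ m) ≡ ι (y ≡ᵇ suc m)
adjacency-D-end₂ m y
  rewrite ≢⇒≡ᵇ-false {3 ℕ.+ m} {1 ℕ.+ m} (n≢2+n (suc m) ∘ sym)
        | ≡ᵇ-refl m | Boolₚ.∧-zeroʳ (y ≡ᵇ 3 ℕ.+ m) | Boolₚ.∨-zeroʳ (y ≡ᵇ 3 ℕ.+ m)
  with y ≡ᵇ 3 ℕ.+ m in y≡3+m
... | true rewrite ≡ᵇ-true⇒≡ y (3 ℕ.+ m) y≡3+m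
                 | ≢⇒≡ᵇ-false {3 ℕ.+ m} {1 ℕ.+ m} (n≢2+n (suc m) ∘ sym) = refl
... | false with y ≡ᵇ suc m
...   | true  = refl
...   | false = refl

-- The sequence of A_{N-1} puts tent N (y + 1) k on node y at step k.  Those of B_{m+2}
-- (N = 2m + 4) and D_{m+4} (N = 2m + 6) are foldings of it: the nodes of the long path keep
-- their values, while the short node of B, resp. each of the two end nodes at the fork of D,
-- carries half the value of the middle node of A_{N-1}.

tent-recurrence : ∀ N {k x a b d} →
                  a ≡ tent N (+ suc x) (+ suc (suc k)) →
                  b ≡ tent N (+ x) (+ suc k) + tent N (+ suc (suc x)) (+ suc k) →
                  d ≡ tent N (+ suc x) (+ k) →
                  a ≡ b - d
tent-recurrence N {k} {x} a≡ b≡ d≡ = trans a≡ (trans (sym (tent-wave N (+ x) (+ k))) (sym (cong₂ _-_ b≡ d≡)))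

half-recurrence : ∀ u {k a b d} →
                  a ≡ half (+ 1 + u) (+ suc (suc k)) →
                  b ≡ tent (+ 1 + u + (+ 1 + u)) u (+ suc k) →
                  d ≡ half (+ 1 + u) (+ k) →
                  a ≡ b - d
half-recurrence u {k} a≡ b≡ d≡ =
  trans a≡ (trans (x≡[x+y]-y _ (half (+ 1 + u) (+ k))) (cong₂ _-_ (trans (half-wave u (+ k)) (sym b≡)) (sym d≡)))
  where
  x≡[x+y]-y : ∀ x y → x ≡ x + y - y
  x≡[x+y]-y = solve-∀

leftNeighbour-tent : ∀ {N v} g x → v ℕ.≤ N → (∀ {y} → suc y ≡ x → g y ≡ tent (+ N) (+ suc y) (+ v)) →
                     leftNeighbour g x ≡ tent (+ N) (+ x) (+ v)
leftNeighbour-tent g zero    v≤N _  = sym (tent-zero v≤N)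
leftNeighbour-tent g (suc x) v≤N eq = eq refl

≤⇒<∨≡ : ∀ {x n} → x ℕ.< suc n → x ℕ.< n ⊎ x ≡ n
≤⇒<∨≡ x<1+n = ℕₚ.m≤n⇒m<n∨m≡n (ℕₚ.≤-pred x<1+n)

chebyshevA : ∀ m → ChebyshevSequence (1 ℕ.+ m) chain (2 ℕ.+ m)
chebyshevA m = record
  { term      = tentA
  ; term-zero = λ x<r → tent-vanishes-bottom (ℕₚ.m≤n⇒m≤1+n x<r)
  ; term-top  = λ x<r → tent-vanishes-top (ℕₚ.m≤n⇒m≤1+n x<r)
  ; term-pos  = λ 0<k k<h x<r → tent-pos (s≤s z≤n) (s≤s x<r) 0<k k<h
  ; term-step = λ {k} {x} k+2≤N x<r → tent-recurrence (+ N) {k} {x} refl (neighbours (ℕₚ.<⇒≤ k+2≤N) x<r) refl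
  }
  where
  N = 2 ℕ.+ m
  tentA : ℕ → ℕ → ℤ
  tentA k y = tent (+ N) (+ suc y) (+ k)
  neighbours : ∀ {v x} → v ℕ.≤ N → x ℕ.< 1 ℕ.+ m →
               neighbourSum (1 ℕ.+ m) chain (tentA v) x ≡ tent (+ N) (+ x) (+ v) + tentA v (suc x)
  neighbours {v} {x} v≤N x<r with ℕₚ.m≤n⇒m<n∨m≡n x<r
  ... | inj₁ x+1<r =
    trans (neighbourSum-chain (tentA v) x+1<r)
          (cong (_+ tentA v (suc x)) (leftNeighbour-tent (tentA v) x v≤N (λ _ → refl)))
  ... | inj₂ refl =
    trans (neighbourSum-chain-last {x} (tentA v))
          (trans (leftNeighbour-tent (tentA v) x v≤N (λ _ → refl))
                 (sym (trans (cong (_+_ (tent (+ N) (+ x) (+ v))) (tent-vanishes-right v≤N)) (ℤₚ.+-identityʳ _))))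

module TypeB (m : ℕ) where

  c = 2 ℕ.+ m
  N = c ℕ.+ c

  tentB : ℕ → ℕ → ℤ
  tentB k y = tent (+ N) (+ suc y) (+ k)

  termˡ : ℕ → ℕ → ℤ
  termˡ k y = if y ≡ᵇ suc m then half (+ c) (+ k) else tentB k y

  termˡ-short : ∀ k → termˡ k (suc m) ≡ half (+ c) (+ k)
  termˡ-short k rewrite ≡ᵇ-refl m = refl

  termˡ-long : ∀ k {y} → y ℕ.≤ m → termˡ k y ≡ tentB k y
  termˡ-long k y≤m rewrite ≢⇒≡ᵇ-false (ℕₚ.<⇒≢ (s≤s y≤m)) = refl

  node<N : ∀ {y} → y ℕ.< c → suc y ℕ.< N
  node<N y<c =
    s≤s (s≤s (ℕₚ.≤-trans (ℕₚ.≤-pred y<c) (ℕₚ.≤-trans (ℕₚ.n≤1+n (suc m)) (ℕₚ.m≤n+m c m))))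

  on-node : ∀ (P : ℕ → Set) {x} → x ℕ.< c → (x ℕ.≤ m → P x) → P (suc m) → P x
  on-node P x<c long short with ≤⇒<∨≡ x<c
  ... | inj₁ x<1+m = long (ℕₚ.≤-pred x<1+m)
  ... | inj₂ refl  = short

  doubleEdgeˡ : (ℕ → ℤ) → ℕ → ℤ
  doubleEdgeˡ g x = sum {c} (λ y → g (toℕ y) * ι ((x ≡ᵇ m) ∧ (toℕ y ≡ᵇ suc m)))

  neighbourSumˡ : ∀ g x → neighbourSum c (adjacency (B m)) g x ≡ neighbourSum c chain g x + doubleEdgeˡ g x
  neighbourSumˡ g x = neighbourSum-split {c} {adjacency (B m)} {chain} {x} (λ y → ι ((x ≡ᵇ m) ∧ (y ≡ᵇ suc m)))
                                         (λ y → adjacency-B m y x) g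

  doubleEdgeˡ-off : ∀ g {x} → x ≢ m → doubleEdgeˡ g x ≡ + 0
  doubleEdgeˡ-off g x≢m rewrite ≢⇒≡ᵇ-false x≢m =
    sum-zero {c} (λ y → g (toℕ y) * ι (false ∧ (toℕ y ≡ᵇ suc m))) (λ y → ℤₚ.*-zeroʳ (g (toℕ y)))

  doubleEdgeˡ-on : ∀ g → doubleEdgeˡ g m ≡ g (suc m)
  doubleEdgeˡ-on g rewrite ≡ᵇ-refl m = sum-point-in {c} g ℕₚ.≤-refl

  leftNeighbour-termˡ : ∀ k x → x ℕ.≤ suc m → suc k ℕ.≤ N →
                        leftNeighbour (termˡ (suc k)) x ≡ tent (+ N) (+ x) (+ suc k)
  leftNeighbour-termˡ k x x≤1+m 1+k≤N =
    leftNeighbour-tent (termˡ (suc k)) x 1+k≤N (λ { refl → termˡ-long (suc k) (ℕₚ.≤-pred x≤1+m) })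

  Recurrenceˡ : ℕ → ℕ → Set
  Recurrenceˡ k x = termˡ (2 ℕ.+ k) x ≡ neighbourSum c (adjacency (B m)) (termˡ (1 ℕ.+ k)) x - termˡ k x

  recurrenceˡ-long : ∀ {k x} → 2 ℕ.+ k ℕ.≤ N → x ℕ.< m → Recurrenceˡ k x
  recurrenceˡ-long {k} {x} k+2≤N x<m =
    tent-recurrence (+ N) {k} {x} (termˡ-long (2 ℕ.+ k) x≤m) neighbours (termˡ-long k x≤m)
    where
    x≤m = ℕₚ.<⇒≤ x<m
    g = termˡ (suc k)
    neighbours : neighbourSum c (adjacency (B m)) g x ≡ tent (+ N) (+ x) (+ suc k) + tentB (suc k) (suc x)
    neighbours = begin
      neighbourSum c (adjacency (B m)) g x                ≡⟨ neighbourSumˡ g x ⟩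
      neighbourSum c chain g x + doubleEdgeˡ g x          ≡⟨ cong₂ _+_ (neighbourSum-chain {c} {x} g (s≤s (s≤s x≤m)))
                                                                       (doubleEdgeˡ-off g (ℕₚ.<⇒≢ x<m)) ⟩
      leftNeighbour g x + g (suc x) + + 0                 ≡⟨ ℤₚ.+-identityʳ _ ⟩
      leftNeighbour g x + g (suc x)
        ≡⟨ cong₂ _+_ (leftNeighbour-termˡ k x (ℕₚ.m≤n⇒m≤1+n x≤m) (ℕₚ.<⇒≤ k+2≤N)) (termˡ-long (suc k) x<m) ⟩
      tent (+ N) (+ x) (+ suc k) + tentB (suc k) (suc x)  ∎
      where open ≡-Reasoning

  recurrenceˡ-double : ∀ {k} → 2 ℕ.+ k ℕ.≤ N → Recurrenceˡ k m
  recurrenceˡ-double {k} k+2≤N =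
    tent-recurrence (+ N) {k} {m} (termˡ-long (2 ℕ.+ k) ℕₚ.≤-refl) neighbours (termˡ-long k ℕₚ.≤-refl)
    where
    g = termˡ (suc k)
    neighbours : neighbourSum c (adjacency (B m)) g m ≡ tent (+ N) (+ m) (+ suc k) + tentB (suc k) (suc m)
    neighbours = begin
      neighbourSum c (adjacency (B m)) g m                ≡⟨ neighbourSumˡ g m ⟩
      neighbourSum c chain g m + doubleEdgeˡ g m
        ≡⟨ cong₂ _+_ (neighbourSum-chain {c} {m} g ℕₚ.≤-refl) (doubleEdgeˡ-on g) ⟩
      leftNeighbour g m + g (suc m) + g (suc m)           ≡⟨ ℤₚ.+-assoc (leftNeighbour g m) (g (suc m)) (g (suc m)) ⟩
      leftNeighbour g m + (g (suc m) + g (suc m))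
        ≡⟨ cong₂ _+_ (leftNeighbour-termˡ k m (ℕₚ.n≤1+n m) (ℕₚ.<⇒≤ k+2≤N))
                     (trans (cong₂ _+_ (termˡ-short (suc k)) (termˡ-short (suc k))) (sym (tent-center (+ c) (+ suc k)))) ⟩
      tent (+ N) (+ m) (+ suc k) + tentB (suc k) (suc m)  ∎
      where open ≡-Reasoning

  recurrenceˡ-short : ∀ {k} → Recurrenceˡ k (suc m)
  recurrenceˡ-short {k} = half-recurrence (+ suc m) (termˡ-short (2 ℕ.+ k)) neighbours (termˡ-short k)
    where
    g = termˡ (suc k)
    neighbours : neighbourSum c (adjacency (B m)) g (suc m) ≡ tentB (suc k) m
    neighbours =
      trans (neighbourSumˡ g (suc m))
            (trans (cong₂ _+_ (neighbourSum-chain-last {suc m} g) (doubleEdgeˡ-off g (n≢1+n m ∘ sym)))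
                   (trans (ℤₚ.+-identityʳ (g m)) (termˡ-long (suc k) ℕₚ.≤-refl)))

  sequenceˡ : ChebyshevSequence c (adjacency (B m)) N
  sequenceˡ = record
    { term      = termˡ
    ; term-zero = λ x<c → on-node (λ x → termˡ 0 x ≡ + 0) x<c
                    (λ x≤m → trans (termˡ-long 0 x≤m) (tent-vanishes-bottom (ℕₚ.<⇒≤ (node<N x<c))))
                    (trans (termˡ-short 0) (half-zero c))
    ; term-top  = λ x<c → on-node (λ x → termˡ N x ≡ + 0) x<c
                    (λ x≤m → trans (termˡ-long N x≤m) (tent-vanishes-top (ℕₚ.<⇒≤ (node<N x<c))))
                    (trans (termˡ-short N) (half-top c))
    ; term-pos  = λ {k} 0<k k<N x<c → on-node (λ x → + 0 < termˡ k x) x<c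
                    (λ x≤m → subst (+ 0 <_) (sym (termˡ-long k x≤m)) (tent-pos (s≤s z≤n) (node<N x<c) 0<k k<N))
                    (subst (+ 0 <_) (sym (termˡ-short k)) (half-pos {c} 0<k k<N))
    ; term-step = λ {k} k+2≤N x<c → on-node (Recurrenceˡ k) x<c
                    (λ x≤m → [ recurrenceˡ-long k+2≤N , (λ { refl → recurrenceˡ-double k+2≤N }) ]′
                               (ℕₚ.m≤n⇒m<n∨m≡n x≤m))
                    recurrenceˡ-short
    }

  doubleEdgeʳ : (ℕ → ℤ) → ℕ → ℤ
  doubleEdgeʳ g x = sum {c} (λ y → g (toℕ y) * ι ((x ≡ᵇ suc m) ∧ (toℕ y ≡ᵇ m)))

  neighbourSumʳ : ∀ g x → neighbourSum c (flip (adjacency (B m))) g x ≡ neighbourSum c chain g x + doubleEdgeʳ g x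
  neighbourSumʳ g x = neighbourSum-split {c} {flip (adjacency (B m))} {chain} {x} (λ y → ι ((x ≡ᵇ suc m) ∧ (y ≡ᵇ m)))
                                         (λ y → adjacency-Bᵀ m y x) g

  doubleEdgeʳ-off : ∀ g {x} → x ≢ suc m → doubleEdgeʳ g x ≡ + 0
  doubleEdgeʳ-off g x≢1+m rewrite ≢⇒≡ᵇ-false x≢1+m =
    sum-zero {c} (λ y → g (toℕ y) * ι (false ∧ (toℕ y ≡ᵇ m))) (λ y → ℤₚ.*-zeroʳ (g (toℕ y)))

  doubleEdgeʳ-on : ∀ g → doubleEdgeʳ g (suc m) ≡ g m
  doubleEdgeʳ-on g rewrite ≡ᵇ-refl m = sum-point-in {c} g (ℕₚ.m≤n⇒m≤1+n (ℕₚ.n<1+n m))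

  tentB-reflect : ∀ k → tentB k (2 ℕ.+ m) ≡ tentB k m
  tentB-reflect k =
    trans (cong (λ u → tent (+ N) u (+ k)) (sym (N-[1+m]≡3+m (+ m)))) (tent-reflect (+ N) (+ suc m) (+ k))
    where
    N-[1+m]≡3+m : ∀ m → (+ 2 + m) + (+ 2 + m) - (+ 1 + m) ≡ + 3 + m
    N-[1+m]≡3+m = solve-∀

  Recurrenceʳ : ℕ → ℕ → Set
  Recurrenceʳ k x = tentB (2 ℕ.+ k) x ≡ neighbourSum c (flip (adjacency (B m))) (tentB (1 ℕ.+ k)) x - tentB k x

  recurrenceʳ-long : ∀ {k x} → 2 ℕ.+ k ℕ.≤ N → x ℕ.≤ m → Recurrenceʳ k x
  recurrenceʳ-long {k} {x} k+2≤N x≤m = tent-recurrence (+ N) {k} {x} refl neighbours refl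
    where
    g = tentB (suc k)
    neighbours : neighbourSum c (flip (adjacency (B m))) g x ≡ tent (+ N) (+ x) (+ suc k) + g (suc x)
    neighbours = begin
      neighbourSum c (flip (adjacency (B m))) g x  ≡⟨ neighbourSumʳ g x ⟩
      neighbourSum c chain g x + doubleEdgeʳ g x   ≡⟨ cong₂ _+_ (neighbourSum-chain {c} {x} g (s≤s (s≤s x≤m)))
                                                                (doubleEdgeʳ-off g (ℕₚ.<⇒≢ (s≤s x≤m))) ⟩
      leftNeighbour g x + g (suc x) + + 0          ≡⟨ ℤₚ.+-identityʳ _ ⟩
      leftNeighbour g x + g (suc x)
        ≡⟨ cong (_+ g (suc x)) (leftNeighbour-tent g x (ℕₚ.<⇒≤ k+2≤N) (λ _ → refl)) ⟩
      tent (+ N) (+ x) (+ suc k) + g (suc x)       ∎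
      where open ≡-Reasoning

  recurrenceʳ-short : ∀ {k} → Recurrenceʳ k (suc m)
  recurrenceʳ-short {k} = tent-recurrence (+ N) {k} {suc m} refl neighbours refl
    where
    g = tentB (suc k)
    neighbours : neighbourSum c (flip (adjacency (B m))) g (suc m) ≡ g m + g (2 ℕ.+ m)
    neighbours = begin
      neighbourSum c (flip (adjacency (B m))) g (suc m)     ≡⟨ neighbourSumʳ g (suc m) ⟩
      neighbourSum c chain g (suc m) + doubleEdgeʳ g (suc m)
        ≡⟨ cong₂ _+_ (neighbourSum-chain-last {suc m} g) (doubleEdgeʳ-on g) ⟩
      g m + g m                                              ≡⟨ cong (_+_ (g m)) (sym (tentB-reflect (suc k))) ⟩
      g m + g (2 ℕ.+ m)                                      ∎
      where open ≡-Reasoning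

  sequenceʳ : ChebyshevSequence c (flip (adjacency (B m))) N
  sequenceʳ = record
    { term      = tentB
    ; term-zero = λ x<c → tent-vanishes-bottom (ℕₚ.<⇒≤ (node<N x<c))
    ; term-top  = λ x<c → tent-vanishes-top (ℕₚ.<⇒≤ (node<N x<c))
    ; term-pos  = λ 0<k k<N x<c → tent-pos (s≤s z≤n) (node<N x<c) 0<k k<N
    ; term-step = λ {k} k+2≤N x<c → on-node (Recurrenceʳ k) x<c (recurrenceʳ-long k+2≤N) recurrenceʳ-short
    }

module TypeD (m : ℕ) where

  r = 4 ℕ.+ m
  c = 3 ℕ.+ m
  N = c ℕ.+ c

  tentD : ℕ → ℕ → ℤ
  tentD k y = tent (+ N) (+ suc y) (+ k)

  termD : ℕ → ℕ → ℤ
  termD k y = if y ≡ᵇ 2 ℕ.+ m then half (+ c) (+ k) else if y ≡ᵇ 3 ℕ.+ m then half (+ c) (+ k) else tentD k y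

  termD-long : ∀ k {y} → y ℕ.≤ suc m → termD k y ≡ tentD k y
  termD-long k y≤1+m
    rewrite ≢⇒≡ᵇ-false (ℕₚ.<⇒≢ (s≤s y≤1+m))
          | ≢⇒≡ᵇ-false (ℕₚ.<⇒≢ (ℕₚ.m≤n⇒m≤1+n (s≤s y≤1+m))) = refl

  termD-end₁ : ∀ k → termD k (2 ℕ.+ m) ≡ half (+ c) (+ k)
  termD-end₁ k rewrite ≡ᵇ-refl m = refl

  termD-end₂ : ∀ k → termD k (3 ℕ.+ m) ≡ half (+ c) (+ k)
  termD-end₂ k rewrite ≢⇒≡ᵇ-false (n≢1+n (2 ℕ.+ m) ∘ sym) | ≡ᵇ-refl m = refl

  node<N : ∀ {y} → y ℕ.≤ suc m → suc y ℕ.< N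
  node<N y≤1+m = s≤s (s≤s (ℕₚ.≤-trans y≤1+m (s≤s (ℕₚ.m≤m+n m c))))

  on-node : ∀ (P : ℕ → Set) {x} → x ℕ.< r → (x ℕ.≤ suc m → P x) → P (2 ℕ.+ m) → P (3 ℕ.+ m) → P x
  on-node P x<r long end₁ end₂ with ≤⇒<∨≡ x<r
  ... | inj₂ refl = end₂
  ... | inj₁ x<3+m with ≤⇒<∨≡ x<3+m
  ...   | inj₂ refl  = end₁
  ...   | inj₁ x<2+m = long (ℕₚ.≤-pred x<2+m)

  Recurrence : ℕ → ℕ → Set
  Recurrence k x = termD (2 ℕ.+ k) x ≡ neighbourSum r (adjacency (D m)) (termD (1 ℕ.+ k)) x - termD k x

  recurrence-path : ∀ {k x} → 2 ℕ.+ k ℕ.≤ N → x ℕ.≤ m → Recurrence k x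
  recurrence-path {k} {x} k+2≤N x≤m =
    tent-recurrence (+ N) {k} {x} (termD-long (2 ℕ.+ k) x≤1+m) neighbours (termD-long k x≤1+m)
    where
    x≤1+m = ℕₚ.m≤n⇒m≤1+n x≤m
    g = termD (suc k)
    neighbours : neighbourSum r (adjacency (D m)) g x ≡ tent (+ N) (+ x) (+ suc k) + tentD (suc k) (suc x)
    neighbours = begin
      neighbourSum r (adjacency (D m)) g x
        ≡⟨ sum-cong-≗ {r} (λ y → cong (λ a → g (toℕ y) * + a) (adjacency-D-path m (toℕ y) x x≤m)) ⟩
      neighbourSum r chain g x
        ≡⟨ neighbourSum-chain {r} {x} g (s≤s (s≤s (ℕₚ.m≤n⇒m≤1+n x≤1+m))) ⟩
      leftNeighbour g x + g (suc x)
        ≡⟨ cong₂ _+_ (leftNeighbour-tent g x (ℕₚ.<⇒≤ k+2≤N)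
                                          (λ { refl → termD-long (suc k) (ℕₚ.≤-trans (ℕₚ.n≤1+n _) x≤1+m) }))
                     (termD-long (suc k) (s≤s x≤m)) ⟩
      tent (+ N) (+ x) (+ suc k) + tentD (suc k) (suc x) ∎
      where open ≡-Reasoning

  recurrence-fork : ∀ {k} → 2 ℕ.+ k ℕ.≤ N → Recurrence k (suc m)
  recurrence-fork {k} k+2≤N =
    tent-recurrence (+ N) {k} {suc m} (termD-long (2 ℕ.+ k) ℕₚ.≤-refl) neighbours (termD-long k ℕₚ.≤-refl)
    where
    g = termD (suc k)
    neighbours : neighbourSum r (adjacency (D m)) g (suc m) ≡ tent (+ N) (+ suc m) (+ suc k) + tentD (suc k) (2 ℕ.+ m)
    neighbours = begin
      neighbourSum r (adjacency (D m)) g (suc m)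
        ≡⟨ neighbourSum-split {r} {adjacency (D m)} {chain} {suc m} (λ y → ι (y ≡ᵇ 3 ℕ.+ m))
                              (adjacency-D-fork m) g ⟩
      neighbourSum r chain g (suc m) + sum {r} (λ y → g (toℕ y) * ι (toℕ y ≡ᵇ 3 ℕ.+ m))
        ≡⟨ cong₂ _+_ (neighbourSum-chain {r} {suc m} g (s≤s (s≤s (s≤s (ℕₚ.n≤1+n m)))))
                     (sum-point-in {r} g ℕₚ.≤-refl) ⟩
      leftNeighbour g (suc m) + g (2 ℕ.+ m) + g (3 ℕ.+ m)
        ≡⟨ ℤₚ.+-assoc (leftNeighbour g (suc m)) (g (2 ℕ.+ m)) (g (3 ℕ.+ m)) ⟩
      leftNeighbour g (suc m) + (g (2 ℕ.+ m) + g (3 ℕ.+ m))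
        ≡⟨ cong₂ _+_ (termD-long (suc k) (ℕₚ.n≤1+n m))
                     (trans (cong₂ _+_ (termD-end₁ (suc k)) (termD-end₂ (suc k))) (sym (tent-center (+ c) (+ suc k)))) ⟩
      tent (+ N) (+ suc m) (+ suc k) + tentD (suc k) (2 ℕ.+ m) ∎
      where open ≡-Reasoning

  recurrence-end : ∀ {k x} → (∀ y → + adjacency (D m) y x ≡ ι (y ≡ᵇ suc m)) →
                   (∀ k → termD k x ≡ half (+ c) (+ k)) → Recurrence k x
  recurrence-end {k} {x} column termD-end = half-recurrence (+ (2 ℕ.+ m)) (termD-end (2 ℕ.+ k)) neighbours (termD-end k)
    where
    g = termD (suc k)
    neighbours : neighbourSum r (adjacency (D m)) g x ≡ tentD (suc k) (suc m)
    neighbours =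
      trans (neighbourSum-≗ {r} {adjacency (D m)} {x} (λ y → ι (y ≡ᵇ suc m)) column g)
            (trans (sum-point-in {r} g (s≤s (ℕₚ.m≤n⇒m≤1+n (ℕₚ.m≤n⇒m≤1+n (ℕₚ.n<1+n m)))))
                   (termD-long (suc k) ℕₚ.≤-refl))

  sequence : ChebyshevSequence r (adjacency (D m)) N
  sequence = record
    { term      = termD
    ; term-zero = λ x<r → on-node (λ x → termD 0 x ≡ + 0) x<r
                    (λ x≤1+m → trans (termD-long 0 x≤1+m) (tent-vanishes-bottom (ℕₚ.<⇒≤ (node<N x≤1+m))))
                    (trans (termD-end₁ 0) (half-zero c)) (trans (termD-end₂ 0) (half-zero c))
    ; term-top  = λ x<r → on-node (λ x → termD N x ≡ + 0) x<r
                    (λ x≤1+m → trans (termD-long N x≤1+m) (tent-vanishes-top (ℕₚ.<⇒≤ (node<N x≤1+m))))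
                    (trans (termD-end₁ N) (half-top c)) (trans (termD-end₂ N) (half-top c))
    ; term-pos  = λ {k} 0<k k<N x<r → on-node (λ x → + 0 < termD k x) x<r
                    (λ x≤1+m → subst (+ 0 <_) (sym (termD-long k x≤1+m)) (tent-pos (s≤s z≤n) (node<N x≤1+m) 0<k k<N))
                    (subst (+ 0 <_) (sym (termD-end₁ k)) (half-pos {c} 0<k k<N))
                    (subst (+ 0 <_) (sym (termD-end₂ k)) (half-pos {c} 0<k k<N))
    ; term-step = λ {k} k+2≤N x<r → on-node (Recurrence k) x<r
                    (λ x≤1+m → [ (λ x<1+m → recurrence-path k+2≤N (ℕₚ.≤-pred x<1+m))
                                 , (λ { refl → recurrence-fork k+2≤N }) ]′ (ℕₚ.m≤n⇒m<n∨m≡n x≤1+m))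
                    (recurrence-end (adjacency-D-end₁ m) termD-end₁)
                    (recurrence-end (adjacency-D-end₂ m) termD-end₂)
    }

entry : ∀ {A : Set} → A → List A → ℕ → A
entry d []       _       = d
entry d (x ∷ xs) zero    = x
entry d (x ∷ xs) (suc k) = entry d xs k

∀Fin⇒∀< : ∀ {n} (P : ℕ → Set) → (∀ (i : Fin n) → P (toℕ i)) → ∀ {x} → x ℕ.< n → P x
∀Fin⇒∀< P P-fin x<n = subst P (Finₚ.toℕ-fromℕ< x<n) (P-fin (fromℕ< x<n))

module Table (r : ℕ) (a : ℕ → ℕ → ℕ) (h : ℕ) (rows : List (List ℤ)) where

  tableTerm : ℕ → ℕ → ℤ
  tableTerm k x = entry (+ 0) (entry [] rows k) x

  Positive Recurrence : ℕ → ℕ → Set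
  Positive k x   = 0 ℕ.< k → + 0 < tableTerm k x
  Recurrence k x = 2 ℕ.+ k ℕ.≤ h → tableTerm (2 ℕ.+ k) x ≡ neighbourSum r a (tableTerm (1 ℕ.+ k)) x - tableTerm k x

  Valid : Set
  Valid = (∀ (x : Fin r) → tableTerm 0 (toℕ x) ≡ + 0)
        × (∀ (x : Fin r) → tableTerm h (toℕ x) ≡ + 0)
        × (∀ (k : Fin h) (x : Fin r) → Positive (toℕ k) (toℕ x))
        × (∀ (k : Fin h) (x : Fin r) → Recurrence (toℕ k) (toℕ x))

  valid? : Dec Valid
  valid? = Finₚ.all? (λ x → tableTerm 0 (toℕ x) ℤₚ.≟ + 0)
     ×-dec Finₚ.all? (λ x → tableTerm h (toℕ x) ℤₚ.≟ + 0)
     ×-dec Finₚ.all? (λ k → Finₚ.all? (λ x →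
             (0 ℕₚ.<? toℕ k) →-dec (+ 0 ℤₚ.<? tableTerm (toℕ k) (toℕ x))))
     ×-dec Finₚ.all? (λ k → Finₚ.all? (λ x →
             (2 ℕ.+ toℕ k ℕₚ.≤? h) →-dec (tableTerm (2 ℕ.+ toℕ k) (toℕ x) ℤₚ.≟ _)))

  on-table : ∀ (P : ℕ → ℕ → Set) → (∀ (k : Fin h) (x : Fin r) → P (toℕ k) (toℕ x)) →
             ∀ {k x} → k ℕ.< h → x ℕ.< r → P k x
  on-table P P-fin {k} {x} k<h x<r = ∀Fin⇒∀< (λ k → P k x) (λ k → ∀Fin⇒∀< (P (toℕ k)) (P-fin k) x<r) k<h

  fromTable : True valid? → ChebyshevSequence r a h
  fromTable valid = record
    { term      = tableTerm
    ; term-zero = ∀Fin⇒∀< (λ x → tableTerm 0 x ≡ + 0) (proj₁ (toWitness valid))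
    ; term-top  = ∀Fin⇒∀< (λ x → tableTerm h x ≡ + 0) (proj₁ (proj₂ (toWitness valid)))
    ; term-pos  = λ 0<k k<h x<r → on-table Positive (proj₁ (proj₂ (proj₂ (toWitness valid)))) k<h x<r 0<k
    ; term-step = λ {k} k+2≤h x<r →
        on-table Recurrence (proj₂ (proj₂ (proj₂ (toWitness valid)))) (ℕₚ.<-trans (ℕₚ.n<1+n k) k+2≤h) x<r k+2≤h
    }

-- The rows are x₀, …, x_h, starting from x₁ = (1, …, 1).
rowsG2ˡ rowsG2ʳ : List (List ℤ)
rowsG2ˡ =   (+ 0 ∷ + 0 ∷ [])
        ∷ (+ 1 ∷ + 1 ∷ [])
        ∷ (+ 3 ∷ + 1 ∷ [])
        ∷ (+ 2 ∷ + 2 ∷ [])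
        ∷ (+ 3 ∷ + 1 ∷ [])
        ∷ (+ 1 ∷ + 1 ∷ [])
        ∷ (+ 0 ∷ + 0 ∷ [])
        ∷ []
rowsG2ʳ =   (+ 0 ∷ + 0 ∷ [])
        ∷ (+ 1 ∷ + 1 ∷ [])
        ∷ (+ 1 ∷ + 3 ∷ [])
        ∷ (+ 2 ∷ + 2 ∷ [])
        ∷ (+ 1 ∷ + 3 ∷ [])
        ∷ (+ 1 ∷ + 1 ∷ [])
        ∷ (+ 0 ∷ + 0 ∷ [])
        ∷ []

rowsE6 : List (List ℤ)
rowsE6 =   (+ 0 ∷ + 0 ∷ + 0 ∷ + 0 ∷ + 0 ∷ + 0 ∷ [])
       ∷ (+ 1 ∷ + 1 ∷ + 1 ∷ + 1 ∷ + 1 ∷ + 1 ∷ [])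
       ∷ (+ 1 ∷ + 1 ∷ + 2 ∷ + 3 ∷ + 2 ∷ + 1 ∷ [])
       ∷ (+ 1 ∷ + 2 ∷ + 3 ∷ + 4 ∷ + 3 ∷ + 1 ∷ [])
       ∷ (+ 2 ∷ + 3 ∷ + 3 ∷ + 5 ∷ + 3 ∷ + 2 ∷ [])
       ∷ (+ 2 ∷ + 3 ∷ + 4 ∷ + 5 ∷ + 4 ∷ + 2 ∷ [])
       ∷ (+ 2 ∷ + 2 ∷ + 4 ∷ + 6 ∷ + 4 ∷ + 2 ∷ [])
       ∷ (+ 2 ∷ + 3 ∷ + 4 ∷ + 5 ∷ + 4 ∷ + 2 ∷ [])
       ∷ (+ 2 ∷ + 3 ∷ + 3 ∷ + 5 ∷ + 3 ∷ + 2 ∷ [])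
       ∷ (+ 1 ∷ + 2 ∷ + 3 ∷ + 4 ∷ + 3 ∷ + 1 ∷ [])
       ∷ (+ 1 ∷ + 1 ∷ + 2 ∷ + 3 ∷ + 2 ∷ + 1 ∷ [])
       ∷ (+ 1 ∷ + 1 ∷ + 1 ∷ + 1 ∷ + 1 ∷ + 1 ∷ [])
       ∷ (+ 0 ∷ + 0 ∷ + 0 ∷ + 0 ∷ + 0 ∷ + 0 ∷ [])
       ∷ []

rowsE7 : List (List ℤ)
rowsE7 =   (+ 0 ∷ + 0 ∷ + 0 ∷ + 0 ∷ + 0 ∷ + 0 ∷ + 0 ∷ [])
       ∷ (+ 1 ∷ + 1 ∷ + 1 ∷ + 1 ∷ + 1 ∷ + 1 ∷ + 1 ∷ [])
       ∷ (+ 1 ∷ + 1 ∷ + 2 ∷ + 3 ∷ + 2 ∷ + 2 ∷ + 1 ∷ [])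
       ∷ (+ 1 ∷ + 2 ∷ + 3 ∷ + 4 ∷ + 4 ∷ + 2 ∷ + 1 ∷ [])
       ∷ (+ 2 ∷ + 3 ∷ + 3 ∷ + 6 ∷ + 4 ∷ + 3 ∷ + 1 ∷ [])
       ∷ (+ 2 ∷ + 4 ∷ + 5 ∷ + 6 ∷ + 5 ∷ + 3 ∷ + 2 ∷ [])
       ∷ (+ 3 ∷ + 3 ∷ + 5 ∷ + 8 ∷ + 5 ∷ + 4 ∷ + 2 ∷ [])
       ∷ (+ 3 ∷ + 4 ∷ + 6 ∷ + 7 ∷ + 7 ∷ + 4 ∷ + 2 ∷ [])
       ∷ (+ 3 ∷ + 4 ∷ + 5 ∷ + 9 ∷ + 6 ∷ + 5 ∷ + 2 ∷ [])
       ∷ (+ 2 ∷ + 5 ∷ + 6 ∷ + 8 ∷ + 7 ∷ + 4 ∷ + 3 ∷ [])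
       ∷ (+ 3 ∷ + 4 ∷ + 5 ∷ + 9 ∷ + 6 ∷ + 5 ∷ + 2 ∷ [])
       ∷ (+ 3 ∷ + 4 ∷ + 6 ∷ + 7 ∷ + 7 ∷ + 4 ∷ + 2 ∷ [])
       ∷ (+ 3 ∷ + 3 ∷ + 5 ∷ + 8 ∷ + 5 ∷ + 4 ∷ + 2 ∷ [])
       ∷ (+ 2 ∷ + 4 ∷ + 5 ∷ + 6 ∷ + 5 ∷ + 3 ∷ + 2 ∷ [])
       ∷ (+ 2 ∷ + 3 ∷ + 3 ∷ + 6 ∷ + 4 ∷ + 3 ∷ + 1 ∷ [])
       ∷ (+ 1 ∷ + 2 ∷ + 3 ∷ + 4 ∷ + 4 ∷ + 2 ∷ + 1 ∷ [])
       ∷ (+ 1 ∷ + 1 ∷ + 2 ∷ + 3 ∷ + 2 ∷ + 2 ∷ + 1 ∷ [])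
       ∷ (+ 1 ∷ + 1 ∷ + 1 ∷ + 1 ∷ + 1 ∷ + 1 ∷ + 1 ∷ [])
       ∷ (+ 0 ∷ + 0 ∷ + 0 ∷ + 0 ∷ + 0 ∷ + 0 ∷ + 0 ∷ [])
       ∷ []

rowsE8 : List (List ℤ)
rowsE8 =   (+ 0 ∷ + 0 ∷ + 0 ∷ + 0 ∷ + 0 ∷ + 0 ∷ + 0 ∷ + 0 ∷ [])
       ∷ (+ 1 ∷ + 1 ∷ + 1 ∷ + 1 ∷ + 1 ∷ + 1 ∷ + 1 ∷ + 1 ∷ [])
       ∷ (+ 1 ∷ + 1 ∷ + 2 ∷ + 3 ∷ + 2 ∷ + 2 ∷ + 2 ∷ + 1 ∷ [])
       ∷ (+ 1 ∷ + 2 ∷ + 3 ∷ + 4 ∷ + 4 ∷ + 3 ∷ + 2 ∷ + 1 ∷ [])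
       ∷ (+ 2 ∷ + 3 ∷ + 3 ∷ + 6 ∷ + 5 ∷ + 4 ∷ + 2 ∷ + 1 ∷ [])
       ∷ (+ 2 ∷ + 4 ∷ + 5 ∷ + 7 ∷ + 6 ∷ + 4 ∷ + 3 ∷ + 1 ∷ [])
       ∷ (+ 3 ∷ + 4 ∷ + 6 ∷ + 9 ∷ + 6 ∷ + 5 ∷ + 3 ∷ + 2 ∷ [])
       ∷ (+ 4 ∷ + 5 ∷ + 7 ∷ + 9 ∷ + 8 ∷ + 5 ∷ + 4 ∷ + 2 ∷ [])
       ∷ (+ 4 ∷ + 5 ∷ + 7 ∷ + 11 ∷ + 8 ∷ + 7 ∷ + 4 ∷ + 2 ∷ [])
       ∷ (+ 3 ∷ + 6 ∷ + 8 ∷ + 11 ∷ + 10 ∷ + 7 ∷ + 5 ∷ + 2 ∷ [])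
       ∷ (+ 4 ∷ + 6 ∷ + 7 ∷ + 13 ∷ + 10 ∷ + 8 ∷ + 5 ∷ + 3 ∷ [])
       ∷ (+ 4 ∷ + 7 ∷ + 9 ∷ + 12 ∷ + 11 ∷ + 8 ∷ + 6 ∷ + 3 ∷ [])
       ∷ (+ 5 ∷ + 6 ∷ + 9 ∷ + 14 ∷ + 10 ∷ + 9 ∷ + 6 ∷ + 3 ∷ [])
       ∷ (+ 5 ∷ + 7 ∷ + 10 ∷ + 13 ∷ + 12 ∷ + 8 ∷ + 6 ∷ + 3 ∷ [])
       ∷ (+ 5 ∷ + 7 ∷ + 9 ∷ + 15 ∷ + 11 ∷ + 9 ∷ + 5 ∷ + 3 ∷ [])
       ∷ (+ 4 ∷ + 8 ∷ + 10 ∷ + 14 ∷ + 12 ∷ + 8 ∷ + 6 ∷ + 2 ∷ [])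
       ∷ (+ 5 ∷ + 7 ∷ + 9 ∷ + 15 ∷ + 11 ∷ + 9 ∷ + 5 ∷ + 3 ∷ [])
       ∷ (+ 5 ∷ + 7 ∷ + 10 ∷ + 13 ∷ + 12 ∷ + 8 ∷ + 6 ∷ + 3 ∷ [])
       ∷ (+ 5 ∷ + 6 ∷ + 9 ∷ + 14 ∷ + 10 ∷ + 9 ∷ + 6 ∷ + 3 ∷ [])
       ∷ (+ 4 ∷ + 7 ∷ + 9 ∷ + 12 ∷ + 11 ∷ + 8 ∷ + 6 ∷ + 3 ∷ [])
       ∷ (+ 4 ∷ + 6 ∷ + 7 ∷ + 13 ∷ + 10 ∷ + 8 ∷ + 5 ∷ + 3 ∷ [])
       ∷ (+ 3 ∷ + 6 ∷ + 8 ∷ + 11 ∷ + 10 ∷ + 7 ∷ + 5 ∷ + 2 ∷ [])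
       ∷ (+ 4 ∷ + 5 ∷ + 7 ∷ + 11 ∷ + 8 ∷ + 7 ∷ + 4 ∷ + 2 ∷ [])
       ∷ (+ 4 ∷ + 5 ∷ + 7 ∷ + 9 ∷ + 8 ∷ + 5 ∷ + 4 ∷ + 2 ∷ [])
       ∷ (+ 3 ∷ + 4 ∷ + 6 ∷ + 9 ∷ + 6 ∷ + 5 ∷ + 3 ∷ + 2 ∷ [])
       ∷ (+ 2 ∷ + 4 ∷ + 5 ∷ + 7 ∷ + 6 ∷ + 4 ∷ + 3 ∷ + 1 ∷ [])
       ∷ (+ 2 ∷ + 3 ∷ + 3 ∷ + 6 ∷ + 5 ∷ + 4 ∷ + 2 ∷ + 1 ∷ [])
       ∷ (+ 1 ∷ + 2 ∷ + 3 ∷ + 4 ∷ + 4 ∷ + 3 ∷ + 2 ∷ + 1 ∷ [])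
       ∷ (+ 1 ∷ + 1 ∷ + 2 ∷ + 3 ∷ + 2 ∷ + 2 ∷ + 2 ∷ + 1 ∷ [])
       ∷ (+ 1 ∷ + 1 ∷ + 1 ∷ + 1 ∷ + 1 ∷ + 1 ∷ + 1 ∷ + 1 ∷ [])
       ∷ (+ 0 ∷ + 0 ∷ + 0 ∷ + 0 ∷ + 0 ∷ + 0 ∷ + 0 ∷ + 0 ∷ [])
       ∷ []

rowsF4ˡ : List (List ℤ)
rowsF4ˡ =   (+ 0 ∷ + 0 ∷ + 0 ∷ + 0 ∷ [])
        ∷ (+ 1 ∷ + 1 ∷ + 1 ∷ + 1 ∷ [])
        ∷ (+ 1 ∷ + 2 ∷ + 3 ∷ + 1 ∷ [])
        ∷ (+ 1 ∷ + 3 ∷ + 4 ∷ + 2 ∷ [])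
        ∷ (+ 2 ∷ + 3 ∷ + 5 ∷ + 3 ∷ [])
        ∷ (+ 2 ∷ + 4 ∷ + 5 ∷ + 3 ∷ [])
        ∷ (+ 2 ∷ + 4 ∷ + 6 ∷ + 2 ∷ [])
        ∷ (+ 2 ∷ + 4 ∷ + 5 ∷ + 3 ∷ [])
        ∷ (+ 2 ∷ + 3 ∷ + 5 ∷ + 3 ∷ [])
        ∷ (+ 1 ∷ + 3 ∷ + 4 ∷ + 2 ∷ [])
        ∷ (+ 1 ∷ + 2 ∷ + 3 ∷ + 1 ∷ [])
        ∷ (+ 1 ∷ + 1 ∷ + 1 ∷ + 1 ∷ [])
        ∷ (+ 0 ∷ + 0 ∷ + 0 ∷ + 0 ∷ [])
        ∷ []

rowsF4ʳ : List (List ℤ)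
rowsF4ʳ =   (+ 0 ∷ + 0 ∷ + 0 ∷ + 0 ∷ [])
        ∷ (+ 1 ∷ + 1 ∷ + 1 ∷ + 1 ∷ [])
        ∷ (+ 1 ∷ + 3 ∷ + 2 ∷ + 1 ∷ [])
        ∷ (+ 2 ∷ + 4 ∷ + 3 ∷ + 1 ∷ [])
        ∷ (+ 3 ∷ + 5 ∷ + 3 ∷ + 2 ∷ [])
        ∷ (+ 3 ∷ + 5 ∷ + 4 ∷ + 2 ∷ [])
        ∷ (+ 2 ∷ + 6 ∷ + 4 ∷ + 2 ∷ [])
        ∷ (+ 3 ∷ + 5 ∷ + 4 ∷ + 2 ∷ [])
        ∷ (+ 3 ∷ + 5 ∷ + 3 ∷ + 2 ∷ [])
        ∷ (+ 2 ∷ + 4 ∷ + 3 ∷ + 1 ∷ [])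
        ∷ (+ 1 ∷ + 3 ∷ + 2 ∷ + 1 ∷ [])
        ∷ (+ 1 ∷ + 1 ∷ + 1 ∷ + 1 ∷ [])
        ∷ (+ 0 ∷ + 0 ∷ + 0 ∷ + 0 ∷ [])
        ∷ []

coxeterNumber-B : ∀ m → coxeterNumber (B m) ≡ TypeB.N m
coxeterNumber-B m = cong (2 ℕ.+ m ℕ.+_) (ℕₚ.+-identityʳ (2 ℕ.+ m))

coxeterNumber-D : ∀ m → coxeterNumber (D m) ≡ TypeD.N m
coxeterNumber-D m = 6+2m≡[3+m]+[3+m] m
  where
  6+2m≡[3+m]+[3+m] : ∀ m → 6 ℕ.+ 2 ℕ.* m ≡ (3 ℕ.+ m) ℕ.+ (3 ℕ.+ m)
  6+2m≡[3+m]+[3+m] = ℕ-Solver.solve-∀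

chebyshevBˡ : ∀ m → ChebyshevSequence (rank (B m)) (adjacency (B m)) (coxeterNumber (B m))
chebyshevBˡ m = subst (ChebyshevSequence (2 ℕ.+ m) (adjacency (B m))) (sym (coxeterNumber-B m)) (TypeB.sequenceˡ m)

chebyshevBʳ : ∀ m → ChebyshevSequence (rank (B m)) (flip (adjacency (B m))) (coxeterNumber (B m))
chebyshevBʳ m = subst (ChebyshevSequence (2 ℕ.+ m) (flip (adjacency (B m)))) (sym (coxeterNumber-B m)) (TypeB.sequenceʳ m)

chebyshevDˡ : ∀ m → ChebyshevSequence (rank (D m)) (adjacency (D m)) (coxeterNumber (D m))
chebyshevDˡ m = subst (ChebyshevSequence (4 ℕ.+ m) (adjacency (D m))) (sym (coxeterNumber-D m)) (TypeD.sequence m)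

chebyshevˡ : ∀ t → ChebyshevSequence (rank t) (adjacency t) (coxeterNumber t)
chebyshevˡ (A m) = ChebyshevSequence-≗ (λ y x → sym (adjacency-A m y x)) (chebyshevA m)
chebyshevˡ (B m) = chebyshevBˡ m
chebyshevˡ (C m) = ChebyshevSequence-≗ (λ y x → sym (adjacency-C m y x)) (chebyshevBʳ (suc m))
chebyshevˡ (D m) = chebyshevDˡ m
chebyshevˡ E6    = Table.fromTable 6 (adjacency E6) 12 rowsE6 _
chebyshevˡ E7    = Table.fromTable 7 (adjacency E7) 18 rowsE7 _
chebyshevˡ E8    = Table.fromTable 8 (adjacency E8) 30 rowsE8 _
chebyshevˡ F4    = Table.fromTable 4 (adjacency F4) 12 rowsF4ˡ _
chebyshevˡ G2    = Table.fromTable 2 (adjacency G2) 6 rowsG2ˡ _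

chebyshevʳ : ∀ t → ChebyshevSequence (rank t) (flip (adjacency t)) (coxeterNumber t)
chebyshevʳ (A m) = ChebyshevSequence-≗ (λ y x → trans (sym (adjacency-A m y x)) (adjacency-A-sym m y x)) (chebyshevA m)
chebyshevʳ (B m) = chebyshevBʳ m
chebyshevʳ (C m) = ChebyshevSequence-≗ (λ y x → sym (adjacency-C m x y)) (chebyshevBˡ (suc m))
chebyshevʳ (D m) = ChebyshevSequence-≗ (adjacency-D-sym m) (chebyshevDˡ m)
chebyshevʳ E6    = Table.fromTable 6 (flip (adjacency E6)) 12 rowsE6 _
chebyshevʳ E7    = Table.fromTable 7 (flip (adjacency E7)) 18 rowsE7 _
chebyshevʳ E8    = Table.fromTable 8 (flip (adjacency E8)) 30 rowsE8 _
chebyshevʳ F4    = Table.fromTable 4 (flip (adjacency F4)) 12 rowsF4ʳ _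
chebyshevʳ G2    = Table.fromTable 2 (flip (adjacency G2)) 6 rowsG2ʳ _

1<coxeterNumber : ∀ t → 1 ℕ.< coxeterNumber t
1<coxeterNumber (A m) = s≤s (s≤s z≤n)
1<coxeterNumber (B m) = s≤s (s≤s z≤n)
1<coxeterNumber (C m) = s≤s (s≤s z≤n)
1<coxeterNumber (D m) = s≤s (s≤s z≤n)
1<coxeterNumber E6    = s≤s (s≤s z≤n)
1<coxeterNumber E7    = s≤s (s≤s z≤n)
1<coxeterNumber E8    = s≤s (s≤s z≤n)
1<coxeterNumber F4    = s≤s (s≤s z≤n)
1<coxeterNumber G2    = s≤s (s≤s z≤n)

0<coxeterNumber : ∀ t → 0 ℕ.< coxeterNumber t
0<coxeterNumber t = ℕₚ.<-trans (s≤s z≤n) (1<coxeterNumber t)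

root : ∀ t → Fin (rank t)
root (A m) = F.zero
root (B m) = F.zero
root (C m) = F.zero
root (D m) = F.zero
root E6    = F.zero
root E7    = F.zero
root E8    = F.zero
root F4    = F.zero
root G2    = F.zero

module Edges {n} (Γ Δ : Mat n) (ΓΔ≡ΔΓ : Admissible Γ Δ) (Δ-nonneg : ∀ i j → + 0 ≤ Δ i j)
             (d : Decomposition (cartanOf Γ)) where

  open Decomposition d
  open Blocks d
  open Form Γ Δ ΓΔ≡ΔΓ

  h : Fin blocks → ℕ
  h b = coxeterNumber (τ b)

  left : Fin blocks → ℕ → Vector ℤ n
  left K k = lift K (term (chebyshevˡ (τ K)) k)

  right : Fin blocks → ℕ → Vector ℤ n
  right L k = lift L (term (chebyshevʳ (τ L)) k)

  left-chebyshev : ∀ K {k} → k ℕ.≤ h K → left K k ≗ chebyshev (_ᵥ* Γ) (left K 1) k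
  left-chebyshev K = lift-chebyshev (_ᵥ* Γ) (ᵥ*-cong Γ) (lift-ᵥ* K) (chebyshevˡ (τ K))

  right-chebyshev : ∀ L {k} → k ℕ.≤ h L → right L k ≗ chebyshev (Γ *ᵥ_) (right L 1) k
  right-chebyshev L = lift-chebyshev (Γ *ᵥ_) (*ᵥ-cong Γ) (*ᵥ-lift L) (chebyshevʳ (τ L))

  ⟨left∣right⟩-transfer : ∀ K L {k} → k ℕ.≤ h K → k ℕ.≤ h L →
                          ⟨ left K k ∣ right L 1 ⟩ ≡ ⟨ left K 1 ∣ right L k ⟩
  ⟨left∣right⟩-transfer K L {k} k≤hK k≤hL =
    trans (⟨∣⟩-congˡ (right L 1) (left-chebyshev K k≤hK))
          (trans (⟨chebyshev∣⟩ (left K 1) (right L 1) k)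
                 (sym (⟨∣⟩-congʳ (left K 1) (right-chebyshev L k≤hL))))

  left-nonneg : ∀ K {k} → 0 ℕ.< k → k ℕ.< h K → ∀ i → + 0 ≤ left K k i
  left-nonneg K 0<k k<h = lift-nonneg K (λ x<r → ℤₚ.<⇒≤ (term-pos (chebyshevˡ (τ K)) 0<k k<h x<r))

  right-nonneg : ∀ L {k} → 0 ℕ.< k → k ℕ.< h L → ∀ i → + 0 ≤ right L k i
  right-nonneg L 0<k k<h = lift-nonneg L (λ x<r → ℤₚ.<⇒≤ (term-pos (chebyshevʳ (τ L)) 0<k k<h x<r))

  left-pos : ∀ i {k} → 0 ℕ.< k → k ℕ.< h (block i) → + 0 < left (block i) k i
  left-pos i {k} 0<k k<h =
    subst (+ 0 <_) (sym (lift-in (term (chebyshevˡ (τ (block i))) k) refl))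
          (term-pos (chebyshevˡ (τ (block i))) 0<k k<h (Finₚ.toℕ<n (proj₂ (to i))))

  right-pos : ∀ i {k} → 0 ℕ.< k → k ℕ.< h (block i) → + 0 < right (block i) k i
  right-pos i {k} 0<k k<h =
    subst (+ 0 <_) (sym (lift-in (term (chebyshevʳ (τ (block i))) k) refl))
          (term-pos (chebyshevʳ (τ (block i))) 0<k k<h (Finₚ.toℕ<n (proj₂ (to i))))

  ⟨left∣right⟩-pos : ∀ {i j k l} → Δ i j ≢ + 0 →
                     0 ℕ.< k → k ℕ.< h (block i) → 0 ℕ.< l → l ℕ.< h (block j) →
                     + 0 < ⟨ left (block i) k ∣ right (block j) l ⟩
  ⟨left∣right⟩-pos {i} {j} Δij≢0 0<k k<h 0<l l<h =
    ⟨∣⟩-pos Δ-nonneg (left-nonneg (block i) 0<k k<h) (right-nonneg (block j) 0<l l<h)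
            (left-pos i 0<k k<h) (ℤₚ.≤∧≢⇒< (Δ-nonneg i j) (Δij≢0 ∘ sym)) (right-pos j 0<l l<h)

  left-top : ∀ K → left K (h K) ≗ (λ _ → + 0)
  left-top K i = trans (lift-cong K (term-top (chebyshevˡ (τ K))) i) (lift-zero K i)

  right-top : ∀ L → right L (h L) ≗ (λ _ → + 0)
  right-top L i = trans (lift-cong L (term-top (chebyshevʳ (τ L))) i) (lift-zero L i)

  Δ-edge : ∀ {i j} → Δ i j ≢ + 0 → h (block i) ≡ h (block j)
  Δ-edge {i} {j} Δij≢0 = ℕₚ.≤-antisym (ℕₚ.≮⇒≥ shorter-right) (ℕₚ.≮⇒≥ shorter-left)
    where
    K = block i
    L = block j
    shorter-left : ¬ h K ℕ.< h L
    shorter-left hK<hL = ℤₚ.<-irrefl (sym vanishes) positive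
      where
      positive : + 0 < ⟨ left K 1 ∣ right L (h K) ⟩
      positive = ⟨left∣right⟩-pos Δij≢0 ℕₚ.≤-refl (1<coxeterNumber (τ K)) (0<coxeterNumber (τ K)) hK<hL
      vanishes : ⟨ left K 1 ∣ right L (h K) ⟩ ≡ + 0
      vanishes = trans (sym (⟨left∣right⟩-transfer K L ℕₚ.≤-refl (ℕₚ.<⇒≤ hK<hL)))
                       (trans (⟨∣⟩-congˡ (right L 1) (left-top K)) (⟨∣⟩-zeroˡ (right L 1)))
    shorter-right : ¬ h L ℕ.< h K
    shorter-right hL<hK = ℤₚ.<-irrefl (sym vanishes) positive
      where
      positive : + 0 < ⟨ left K (h L) ∣ right L 1 ⟩
      positive = ⟨left∣right⟩-pos Δij≢0 (0<coxeterNumber (τ L)) hL<hK ℕₚ.≤-refl (1<coxeterNumber (τ L))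
      vanishes : ⟨ left K (h L) ∣ right L 1 ⟩ ≡ + 0
      vanishes = trans (⟨left∣right⟩-transfer K L (ℕₚ.<⇒≤ hL<hK) ℕₚ.≤-refl)
                       (trans (⟨∣⟩-congʳ (left K 1) (right-top L)) (⟨∣⟩-zeroʳ (left K 1)))

  Γ-edge : ∀ {i j} → Γ i j ≢ + 0 → h (block i) ≡ h (block j)
  Γ-edge {i} {j} Γij≢0 with block i ≟ block j
  ... | yes bi≡bj = cong (coxeterNumber ∘ τ) bi≡bj
  ... | no bi≢bj  = ⊥-elim (Γij≢0 (Γ-between bi≢bj))

  edge : ∀ {i j} → (Γ ⊕ Δ) i j ≢ + 0 → h (block i) ≡ h (block j)
  edge {i} {j} ≢0 with Γ i j ℤₚ.≟ + 0
  ... | no Γij≢0  = Γ-edge Γij≢0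
  ... | yes Γij≡0 = Δ-edge (λ Δij≡0 → ≢0 (cong₂ _+_ Γij≡0 Δij≡0))

  walk : ∀ {i j} → Walk Γ Δ i j → h (block i) ≡ h (block j)
  walk here                = refl
  walk (step (inj₁ ij) w) = trans (edge ij) (walk w)
  walk (step (inj₂ ji) w) = trans (sym (edge ji)) (walk w)

  sameCoxeterNumber : Connected Γ Δ → ∀ b b′ → h b ≡ h b′
  sameCoxeterNumber connected b b′ =
    subst₂ (λ c c′ → h c ≡ h c′) (block-from b (root (τ b))) (block-from b′ (root (τ b′)))
           (walk (connected (from (b , root (τ b))) (from (b′ , root (τ b′)))))

sameCoxeterNumber : ∀ {n} {Γ Δ : Mat n} → Admissible Γ Δ → (∀ i j → + 0 ≤ Δ i j) →
                    Connected Γ Δ → SameCoxeterNumber Γ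
sameCoxeterNumber ΓΔ≡ΔΓ Δ-nonneg connected d = Edges.sameCoxeterNumber _ _ ΓΔ≡ΔΓ Δ-nonneg d connected

walk-swap : ∀ {n} {Γ Δ : Mat n} {i j} → Walk Γ Δ i j → Walk Δ Γ i j
walk-swap here = here
walk-swap {Γ = Γ} {Δ} (step {i} {j} (inj₁ ij) w) = step (inj₁ (ij ∘ trans (ℤₚ.+-comm (Γ i j) (Δ i j)))) (walk-swap w)
walk-swap {Γ = Γ} {Δ} (step {i} {j} (inj₂ ji) w) = step (inj₂ (ji ∘ trans (ℤₚ.+-comm (Γ j i) (Δ j i)))) (walk-swap w)

corollary3p14 : ∀ {n} (Γ Δ : Mat n) → IsDynkinBiagram Γ Δ → Admissible Γ Δ →
                  Connected Γ Δ → SameCoxeterNumber Γ × SameCoxeterNumber Δ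
corollary3p14 Γ Δ biagram ΓΔ≡ΔΓ connected =
  sameCoxeterNumber ΓΔ≡ΔΓ (Blocks.Γ-nonneg Δ-cox) connected ,
  sameCoxeterNumber (λ i j → sym (ΓΔ≡ΔΓ i j)) (Blocks.Γ-nonneg Γ-cox) (λ i j → walk-swap (connected i j))
  where open IsDynkinBiagram biagram
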